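{- Let $B=[\mathbf a|\mathbf b]$ be a rank-2 integer $2\times 2$ matrix and $\Lambda=[\mathbf u|\mathbf v]B\mathbb Z^2$. Then the set of types $\{t(\tau,\Lambda)\mid \tau\in T_\Lambda\}$ coincides with the intersection of the fundamental triangle with $\Delta(\tau_D,B)+(3\mathbb Z)^2$; that is, a triple $(L,D,R)\in\mathbb N^3$ with $L+D+R=[\Lambda_0:\Lambda]$ is the type of some $\Lambda$-periodic tiling if and only if the point $\frac{1}{[\Lambda_0:\Lambda]}\bigl(L\Delta(\tau_L,B)+D\Delta(\tau_D,B)+R\Delta(\tau_R,B)\bigr)$ lies in $\Delta(\tau_D,B)+(3\mathbb Z)^2$; equivalently, the set of fingerprints $\{\Delta(\tau,B)\mid\tau\in T_\Lambda\}$ equals the set of points of the closed triangle with vertices $\Delta(\tau_L,B),\Delta(\tau_D,B),\Delta(\tau_R,B)$ that lie in $\Delta(\tau_D,B)+(3\mathbb Z)^2$.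
   Context: Let $\mathbf u=(1,0)$, $\mathbf v=(1/2,\sqrt3/2)$, $\Lambda_0=\mathbb Z\mathbf u+\mathbb Z\mathbf v$. For $B=[\mathbf a|\mathbf b]$ with columns $\mathbf a=(a_1,a_2)^t,\mathbf b=(b_1,b_2)^t$, $\Lambda=[\mathbf u|\mathbf v]B\mathbb Z^2$ is generated by $a_1\mathbf u+a_2\mathbf v$ and $b_1\mathbf u+b_2\mathbf v$, and $[\Lambda_0:\Lambda]=|\det B|$. Define $\xi(L)=\mathbf v-\mathbf u$, $\xi(D)=\mathbf 0$, $\xi(R)=\mathbf v$. A $\Lambda$-periodic tiling is a map $\tau:\Lambda_0\to\{L,D,R\}$ with $\tau(\mathbf x+\mathbf y)=\tau(\mathbf x)$ for $\mathbf x\in\Lambda_0,\mathbf y\in\Lambda$ and such that $\mathbf x\mapsto\mathbf x+\xi(\tau(\mathbf x))$ is a bijection of $\Lambda_0$; $T_\Lambda$ is the set of these. The type $t(\tau,\Lambda)=(n_L,n_D,n_R)$ counts the classes of $\Lambda_0/\Lambda$ on which $\tau$ takes each value. $\tau_L,\tau_D,\tau_R$ denote the constant tilings. Heights: a path in $\tau$ is a sequence $(\mathbf x_i)_{i=0}^N\subseteq\Lambda_0$ with steps in $\{\pm\mathbf u,\pm\mathbf v,\pm(\mathbf u-\mathbf v)\}$ such that: a step $\mathbf u$ requires $\tau(\mathbf x_i)\ne D$; a step $\mathbf v$ requires $\tau(\mathbf x_i)\ne L$; a step $\mathbf v-\mathbf u$ requires $\tau(\mathbf x_i-\mathbf u)\ne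 R$; a step $-\mathbf u$ requires $\tau(\mathbf x_i-\mathbf u)\ne D$; a step $-\mathbf v$ requires $\tau(\mathbf x_i-\mathbf v)\ne L$; a step $\mathbf u-\mathbf v$ requires $\tau(\mathbf x_i-\mathbf v)\neq R$. Step weights: $f(\mathbf u)=-1$, $f(-\mathbf u)=1$, $f(\mathbf v)=1$, $f(-\mathbf v)=-1$, $f(\mathbf u-\mathbf v)=1$, $f(\mathbf v-\mathbf u)=-1$. Every $\mathbf x\in\Lambda_0$ is reached from $\mathbf 0$ by a path in $\tau$, and the sum of $f$ over the steps depends only on the endpoints; $h_\tau(\mathbf x)$ denotes this sum for a path from $\mathbf 0$ to $\mathbf x$. The fingerprint of $\tau$ in $B$ is $\Delta(\tau,B)=\bigl(h_\tau(a_1\mathbf u+a_2\mathbf v),\,h_\tau(b_1\mathbf u+b_2\mathbf v)\bigr)\in\mathbb Z^2$. The fundamental triangle of $B$ is the closed triangle in $\mathbb R^2$ with vertices $\Delta(\tau_L,B),\Delta(\tau_D,B),\Delta(\tau_R,B)$; a type $(L,D,R)$ is identified with the point of this triangle with barycentric coordinates $(L,D,R)/[\Lambda_0:\Lambda]$. -}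

module Defs where

open import Data.Integer using (ℤ; +_; -_; _+_; _-_; _*_; ∣_∣)
open import Data.Nat as ℕ using (ℕ)
open import Data.Product using (Σ; _×_; _,_; ∃; proj₁; proj₂)
open import Data.List using (List; length; map; lookup; filterᵇ)
open import Data.Fin using (Fin)
open import Data.Bool using (Bool; true; false)
open import Relation.Binary.PropositionalEquality using (_≡_; _≢_)
open import Function.Definitions using (Bijective)

-- Points of Λ₀ = ℤu + ℤv, written in (u,v)-coordinates: (m , n) ↦ m u + n v.
Pt : Set
Pt = ℤ × ℤ

_⊕_ : Pt → Pt → Pt
(a , b) ⊕ (c , d) = (a + c , b + d)

_⊖_ : Pt → Pt → Pt
(a , b) ⊖ (c , d) = (a - c , b - d)

_·_ : ℤ → Pt → Pt
k · (a , b) = (k * a , k * b)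

infixl 6 _⊕_ _⊖_
infixl 7 _·_

𝟎 𝐮 𝐯 : Pt
𝟎 = (+ 0 , + 0)
𝐮 = (+ 1 , + 0)
𝐯 = (+ 0 , + 1)

record Mat : Set where
  constructor [_∣_]
  field
    col-a : Pt
    col-b : Pt
open Mat public

det : Mat → ℤ
det [ (a₁ , a₂) ∣ (b₁ , b₂) ] = a₁ * b₂ - a₂ * b₁

index : Mat → ℕ
index B = ∣ det B ∣

-- x ∈ Λ = [u|v] B ℤ²  (in (u,v)-coordinates: x = m a + n b)
InΛ : Mat → Pt → Set
InΛ B x = Σ ℤ λ m → Σ ℤ λ n → x ≡ m · col-a B ⊕ n · col-b B

data Tile : Set where
  L D R : Tile

ξ : Tile → Pt
ξ L = 𝐯 ⊖ 𝐮
ξ D = 𝟎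
ξ R = 𝐯

IsTiling : Mat → (Pt → Tile) → Set
IsTiling B τ =
  ((x y : Pt) → InΛ B y → τ (x ⊕ y) ≡ τ x) ×
  Bijective _≡_ _≡_ (λ x → x ⊕ ξ (τ x))

constTiling : Tile → Pt → Tile
constTiling t _ = t

-- Type of a tiling: count classes of Λ₀/Λ via a complete system of
-- representatives (a transversal) of Λ₀/Λ.
IsTransversal : Mat → List Pt → Set
IsTransversal B xs =
  ((x : Pt) → Σ (Fin (length xs)) λ i → InΛ B (x ⊖ lookup xs i)) ×
  ((i j : Fin (length xs)) → InΛ B (lookup xs i ⊖ lookup xs j) → i ≡ j)

_==ᵗ_ : Tile → Tile → Bool
L ==ᵗ L = true
D ==ᵗ D = true
R ==ᵗ R = true
_ ==ᵗ _ = false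

count : Tile → List Tile → ℕ
count t ts = length (filterᵇ (t ==ᵗ_) ts)

HasType : Mat → (Pt → Tile) → ℕ → ℕ → ℕ → Set
HasType B τ nL nD nR = Σ (List Pt) λ xs → IsTransversal B xs ×
  (count L (map τ xs) ≡ nL × count D (map τ xs) ≡ nD × count R (map τ xs) ≡ nR)

-- Paths in τ with accumulated weight: Path τ x y k means there is a path
-- from x to y whose f-weights sum to k.
data Path (τ : Pt → Tile) : Pt → Pt → ℤ → Set where
  done : ∀ {x} → Path τ x x (+ 0)
  step+u : ∀ {x y k} → τ x ≢ D → Path τ (x ⊕ 𝐮) y k → Path τ x y (- (+ 1) + k)
  step+v : ∀ {x y k} → τ x ≢ L → Path τ (x ⊕ 𝐯) y k → Path τ x y (+ 1 + k)
  step+v-u : ∀ {x y k} → τ (x ⊖ 𝐮) ≢ R → Path τ (x ⊕ (𝐯 ⊖ 𝐮)) y k → Path τ x y (- (+ 1) + k)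
  step-u : ∀ {x y k} → τ (x ⊖ 𝐮) ≢ D → Path τ (x ⊖ 𝐮) y k → Path τ x y (+ 1 + k)
  step-v : ∀ {x y k} → τ (x ⊖ 𝐯) ≢ L → Path τ (x ⊖ 𝐯) y k → Path τ x y (- (+ 1) + k)
  step+u-v : ∀ {x y k} → τ (x ⊖ 𝐯) ≢ R → Path τ (x ⊕ (𝐮 ⊖ 𝐯)) y k → Path τ x y (+ 1 + k)

Height : (Pt → Tile) → Pt → ℤ → Set
Height τ x k = Path τ 𝟎 x k

Fingerprint : (Pt → Tile) → Mat → Pt → Set
Fingerprint τ B (p , q) = Height τ (col-a B) p × Height τ (col-b B) q

-- (1/N)(L ΔL + D ΔD + R ΔR) ∈ ΔD + (3ℤ)², with denominators cleared:
-- L ΔL + D ΔD + R ΔR = N (ΔD + 3k) for some k ∈ ℤ².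
InCoset : ℕ → ℕ → ℕ → ℕ → Pt → Pt → Pt → Set
InCoset N nL nD nR ΔL ΔD ΔR =
  Σ Pt λ k → (+ nL) · ΔL ⊕ (+ nD) · ΔD ⊕ (+ nR) · ΔR ≡ (+ N) · (ΔD ⊕ (+ 3) · k)

module Submission where

-- Heights of the constant tilings are linear forms, and the coset condition turns out to say exactly that
-- |det B| divides n ∙ a and n ∙ b, where n = (nL + nR, nL) is normal to the total displacement
-- nL ξ(L) + nR ξ(R) of a tiling of type (nL, nD, nR).
-- Necessity: x ↦ x + ξ(τ x) permutes the classes of Λ₀/Λ, so summing ξ(τ x) over a transversal telescopes
-- to a vector of Λ; by Cramer's rule this is the divisibility condition.
-- Sufficiency: divide the type by e = gcd(nL, nD, nR) and put D, R, L on consecutive blocks of Dp, Rp, Lp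
-- residues of φ = n / e modulo Np = |det B| / e. Moving by ξ exchanges the R- and L-blocks of residues, so it is
-- a bijection; and a point t₀ with φ t₀ ≡ 1 (Bézout) permutes the classes of a transversal (built from the Hermite
-- normal form of B) while raising residues by one, so every residue occurs e times and the type is (nL, nD, nR).

open import Defs
open import Data.Nat using (ℕ; NonZero)

module Points where

  open import Data.Integer using (ℤ; _+_; _-_; _*_)
  open import Data.Integer.Tactic.RingSolver using (solve-∀)
  open import Data.Product using (_,_)
  open import Data.Product.Properties using (×-≡,≡→≡)
  open import Relation.Binary.PropositionalEquality using (_≡_; cong; sym; trans)

  infix 8 _∙_

  _∙_ : Pt → Pt → ℤ
  (α , β) ∙ (x₁ , x₂) = α * x₁ + β * x₂

  ∙-distribˡ-⊕ : ∀ w x y → w ∙ (x ⊕ y) ≡ w ∙ x + w ∙ y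
  ∙-distribˡ-⊕ (α , β) (x₁ , x₂) (y₁ , y₂) = law α β x₁ x₂ y₁ y₂
    where law : ∀ α β x₁ x₂ y₁ y₂ → α * (x₁ + y₁) + β * (x₂ + y₂) ≡ (α * x₁ + β * x₂) + (α * y₁ + β * y₂)
          law = solve-∀

  ∙-distribˡ-⊖ : ∀ w x y → w ∙ (x ⊖ y) ≡ w ∙ x - w ∙ y
  ∙-distribˡ-⊖ (α , β) (x₁ , x₂) (y₁ , y₂) = law α β x₁ x₂ y₁ y₂
    where law : ∀ α β x₁ x₂ y₁ y₂ → α * (x₁ - y₁) + β * (x₂ - y₂) ≡ (α * x₁ + β * x₂) - (α * y₁ + β * y₂)
          law = solve-∀

  ∙-·-comm : ∀ w k x → w ∙ (k · x) ≡ k * (w ∙ x)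
  ∙-·-comm (α , β) k (x₁ , x₂) = law α β k x₁ x₂
    where law : ∀ α β k x₁ x₂ → α * (k * x₁) + β * (k * x₂) ≡ k * (α * x₁ + β * x₂)
          law = solve-∀

  x⊕[y⊖x]≡y : ∀ x y → x ⊕ (y ⊖ x) ≡ y
  x⊕[y⊖x]≡y (x₁ , x₂) (y₁ , y₂) = ×-≡,≡→≡ (law x₁ y₁ , law x₂ y₂)
    where law : ∀ x y → x + (y - x) ≡ y
          law = solve-∀

  [x⊖y]⊕y≡x : ∀ x y → (x ⊖ y) ⊕ y ≡ x
  [x⊖y]⊕y≡x (x₁ , x₂) (y₁ , y₂) = ×-≡,≡→≡ (law x₁ y₁ , law x₂ y₂)
    where law : ∀ x y → x - y + y ≡ x
          law = solve-∀

  [x⊕y]⊖y≡x : ∀ x y → (x ⊕ y) ⊖ y ≡ x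
  [x⊕y]⊖y≡x (x₁ , x₂) (y₁ , y₂) = ×-≡,≡→≡ (law x₁ y₁ , law x₂ y₂)
    where law : ∀ x y → x + y - y ≡ x
          law = solve-∀

  ⊕-cancelʳ : ∀ {x y} z → x ⊕ z ≡ y ⊕ z → x ≡ y
  ⊕-cancelʳ {x} {y} z eq = trans (sym ([x⊕y]⊖y≡x x z)) (trans (cong (_⊖ z) eq) ([x⊕y]⊖y≡x y z))

  [x⊕z]⊖[y⊕z]≡x⊖y : ∀ x y z → (x ⊕ z) ⊖ (y ⊕ z) ≡ x ⊖ y
  [x⊕z]⊖[y⊕z]≡x⊖y (x₁ , x₂) (y₁ , y₂) (z₁ , z₂) = ×-≡,≡→≡ (law x₁ y₁ z₁ , law x₂ y₂ z₂)
    where law : ∀ x y z → (x + z) - (y + z) ≡ x - y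
          law = solve-∀

  [x⊖z]⊖[y⊖z]≡x⊖y : ∀ x y z → (x ⊖ z) ⊖ (y ⊖ z) ≡ x ⊖ y
  [x⊖z]⊖[y⊖z]≡x⊖y (x₁ , x₂) (y₁ , y₂) (z₁ , z₂) = ×-≡,≡→≡ (law x₁ y₁ z₁ , law x₂ y₂ z₂)
    where law : ∀ x y z → (x - z) - (y - z) ≡ x - y
          law = solve-∀

  [x⊕y]⊖x≡y : ∀ x y → (x ⊕ y) ⊖ x ≡ y
  [x⊕y]⊖x≡y (x₁ , x₂) (y₁ , y₂) = ×-≡,≡→≡ (law x₁ y₁ , law x₂ y₂)
    where law : ∀ x y → x + y - x ≡ y
          law = solve-∀

  [y⊕[p⊖[y⊕q]]]⊕q≡p : ∀ y p q → (y ⊕ (p ⊖ (y ⊕ q))) ⊕ q ≡ p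
  [y⊕[p⊖[y⊕q]]]⊕q≡p (y₁ , y₂) (p₁ , p₂) (q₁ , q₂) = ×-≡,≡→≡ (law y₁ p₁ q₁ , law y₂ p₂ q₂)
    where law : ∀ y p q → y + (p - (y + q)) + q ≡ p
          law = solve-∀

module Heights where

  open Points
  open import Data.Integer using (ℤ; +_; _+_; _-_; -_)
  open import Data.Integer.Properties using (+-identityʳ; +-inverseʳ)
  open import Data.Integer.Tactic.RingSolver using (solve-∀)
  open import Data.Empty using (⊥-elim)
  open import Data.Product using (_,_)
  open import Data.Product.Properties using (×-≡,≡→≡)
  open import Relation.Binary.PropositionalEquality using (_≡_; refl; sym; trans)

  heightVector : Tile → Pt
  heightVector L = (- + 1 , - + 2)
  heightVector D = (+ 2 , + 1)
  heightVector R = (- + 1 , + 1)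

  height : Tile → Pt → ℤ
  height t x = heightVector t ∙ x

  ⊕-step : ∀ t s x y {k} → k ≡ height t y - height t (x ⊕ s) → height t s + k ≡ height t y - height t x
  ⊕-step t s x y refl rewrite ∙-distribˡ-⊕ (heightVector t) x s = law (height t s) (height t y) (height t x)
    where law : ∀ w a b → w + (a - (b + w)) ≡ a - b
          law = solve-∀

  ⊖-step : ∀ t s x y {k} → k ≡ height t y - height t (x ⊖ s) → - height t s + k ≡ height t y - height t x
  ⊖-step t s x y refl rewrite ∙-distribˡ-⊖ (heightVector t) x s = law (height t s) (height t y) (height t x)
    where law : ∀ w a b → - w + (a - (b - w)) ≡ a - b
          law = solve-∀

  -- Every step allowed in the constant tiling τ_t has weight height t (step), so f-weights telescope.
  path-weight-const : ∀ t {x y k} → Path (constTiling t) x y k → k ≡ height t y - height t x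
  path-weight-const t {x} done = sym (+-inverseʳ (height t x))
  path-weight-const L {x} {y} (step+u _ p)           = ⊕-step L 𝐮 x y (path-weight-const L p)
  path-weight-const R {x} {y} (step+u _ p)           = ⊕-step R 𝐮 x y (path-weight-const R p)
  path-weight-const D (step+u ne _)                  = ⊥-elim (ne refl)
  path-weight-const D {x} {y} (step+v _ p)           = ⊕-step D 𝐯 x y (path-weight-const D p)
  path-weight-const R {x} {y} (step+v _ p)           = ⊕-step R 𝐯 x y (path-weight-const R p)
  path-weight-const L (step+v ne _)                  = ⊥-elim (ne refl)
  path-weight-const L {x} {y} (step+v-u _ p)         = ⊕-step L (𝐯 ⊖ 𝐮) x y (path-weight-const L p)
  path-weight-const D {x} {y} (step+v-u _ p)         = ⊕-step D (𝐯 ⊖ 𝐮) x y (path-weight-const D p)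
  path-weight-const R (step+v-u ne _)                = ⊥-elim (ne refl)
  path-weight-const L {x} {y} (step-u _ p)           = ⊖-step L 𝐮 x y (path-weight-const L p)
  path-weight-const R {x} {y} (step-u _ p)           = ⊖-step R 𝐮 x y (path-weight-const R p)
  path-weight-const D (step-u ne _)                  = ⊥-elim (ne refl)
  path-weight-const D {x} {y} (step-v _ p)           = ⊖-step D 𝐯 x y (path-weight-const D p)
  path-weight-const R {x} {y} (step-v _ p)           = ⊖-step R 𝐯 x y (path-weight-const R p)
  path-weight-const L (step-v ne _)                  = ⊥-elim (ne refl)
  path-weight-const L {x} {y} (step+u-v _ p)         = ⊕-step L (𝐮 ⊖ 𝐯) x y (path-weight-const L p)
  path-weight-const D {x} {y} (step+u-v _ p)         = ⊕-step D (𝐮 ⊖ 𝐯) x y (path-weight-const D p)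
  path-weight-const R (step+u-v ne _)                = ⊥-elim (ne refl)

  constFingerprint : Tile → Mat → Pt
  constFingerprint t B = (height t (col-a B) , height t (col-b B))

  -- Split on t: height t 𝟎 computes to 0 only for a concrete tile.
  Height-const : ∀ t {y k} → Height (constTiling t) y k → k ≡ height t y
  Height-const L {y} h = trans (path-weight-const L h) (+-identityʳ (height L y))
  Height-const D {y} h = trans (path-weight-const D h) (+-identityʳ (height D y))
  Height-const R {y} h = trans (path-weight-const R h) (+-identityʳ (height R y))

  fingerprint-const : ∀ t B {Δ} → Fingerprint (constTiling t) B Δ → Δ ≡ constFingerprint t B
  fingerprint-const t B (ha , hb) = ×-≡,≡→≡ (Height-const t ha , Height-const t hb)

module IntegerArithmetic where

  open import Data.Integer using (ℤ; +_; -_; _+_; _-_; _*_; ∣_∣; 0ℤ; _%ℕ_; _/ℕ_) renaming (_⊖_ to _⊝_)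
  open import Data.Integer.DivMod using (a≡a%ℕn+[a/ℕn]*n; n%ℕd<d)
  import Data.Integer.Properties as ℤₚ
  open import Data.Integer.Tactic.RingSolver using (solve-∀)
  open import Data.Nat as ℕ using (ℕ; NonZero)
  open import Data.Nat.GCD using (gcd; gcd-GCD; gcd[m,n]∣m; gcd[m,n]∣n; module Bézout)
  open import Data.Integer.Divisibility.Signed using (divides; m∣∣m∣; ∣ᵤ⇒∣)
  open import Data.Product using (∃; ∃₂; _,_)
  import Data.Nat.Properties as ℕₚ
  open import Relation.Binary.PropositionalEquality using (_≡_; refl; cong; cong₂; sym; trans; module ≡-Reasoning)

  x≡r+q⇒x-r≡q : ∀ {x r q} → x ≡ r + q → x - r ≡ q
  x≡r+q⇒x-r≡q {r = r} {q} refl = law r q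
    where law : ∀ r q → r + q - r ≡ q
          law = solve-∀

  x-y≡x⇒y≡0 : ∀ x y → x - y ≡ x → y ≡ 0ℤ
  x-y≡x⇒y≡0 x y eq = trans (law₁ x y) (trans (cong (λ z → x - z) eq) (ℤₚ.+-inverseʳ x))
    where law₁ : ∀ x y → y ≡ x - (x - y)
          law₁ = solve-∀

  multiple<bound⇒0 : ∀ {c i j} μ → i ℕ.< c → j ℕ.< c → + i - + j ≡ μ * + c → μ ≡ 0ℤ
  multiple<bound⇒0 {c} {i} {j} μ i<c j<c eq = ℤₚ.∣i∣≡0⇒i≡0 (ℕₚ.n<1⇒n≡0 (ℕₚ.*-cancelʳ-< c ∣ μ ∣ 1 ∣μ∣c<c))
    where
    ∣μ∣c<c : ∣ μ ∣ ℕ.* c ℕ.< 1 ℕ.* c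
    ∣μ∣c<c = begin-strict
      ∣ μ ∣ ℕ.* c      ≡⟨ sym (ℤₚ.abs-* μ (+ c)) ⟩
      ∣ μ * + c ∣      ≡⟨ cong ∣_∣ (trans (sym eq) (ℤₚ.[+m]-[+n]≡m⊖n i j)) ⟩
      ∣ i ⊝ j ∣         ≤⟨ ℤₚ.∣m⊝n∣≤m⊔n i j ⟩
      i ℕ.⊔ j          <⟨ ℕₚ.⊔-pres-<m i<c j<c ⟩
      c                ≡⟨ sym (ℕₚ.*-identityˡ c) ⟩
      1 ℕ.* c          ∎
      where open ℕₚ.≤-Reasoning

  multiple<bound⇒≡ : ∀ {c i j} μ → i ℕ.< c → j ℕ.< c → + i - + j ≡ μ * + c → i ≡ j
  multiple<bound⇒≡ {c} {i} {j} μ i<c j<c eq = ℤₚ.+-injective (ℤₚ.i-j≡0⇒i≡j (+ i) (+ j) i-j≡0)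
    where
    i-j≡0 : + i - + j ≡ 0ℤ
    i-j≡0 = trans eq (cong (_* + c) (multiple<bound⇒0 μ i<c j<c eq))

  %ℕ-unique : ∀ z {r} q n .{{_ : NonZero n}} → r ℕ.< n → z ≡ + r + q * + n → z %ℕ n ≡ r
  %ℕ-unique z {r} q n r<n z≡r+qn = multiple<bound⇒≡ (q - z /ℕ n) (n%ℕd<d z n) r<n difference
    where
    open ≡-Reasoning
    difference : + (z %ℕ n) - + r ≡ (q - z /ℕ n) * + n
    difference = begin
      + (z %ℕ n) - + r                                          ≡⟨ shift (+ (z %ℕ n)) (+ r) (z /ℕ n) q (+ n) ⟩
      (+ (z %ℕ n) + z /ℕ n * + n) - (+ r + q * + n) + (q - z /ℕ n) * + n
        ≡⟨ cong₂ (λ u v → u - v + (q - z /ℕ n) * + n) (sym (a≡a%ℕn+[a/ℕn]*n z n)) (sym z≡r+qn) ⟩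
      z - z + (q - z /ℕ n) * + n                                ≡⟨ cancel z _ ⟩
      (q - z /ℕ n) * + n                                        ∎
      where
      shift : ∀ a b p q n → a - b ≡ (a + p * n) - (b + q * n) + (q - p) * n
      shift = solve-∀
      cancel : ∀ z w → z - z + w ≡ w
      cancel = solve-∀

  private
    lift : ∀ a b c d e → a ℕ.+ b ℕ.* c ≡ d ℕ.* e → + a + + b * + c ≡ + d * + e
    lift a b c d e eq = begin
      + a + + b * + c      ≡⟨ cong (λ w → + a + w) (ℤₚ.pos-* b c) ⟨
      + a + + (b ℕ.* c)    ≡⟨ ℤₚ.pos-+ a (b ℕ.* c) ⟨
      + (a ℕ.+ b ℕ.* c)    ≡⟨ cong +_ eq ⟩
      + (d ℕ.* e)          ≡⟨ ℤₚ.pos-* d e ⟩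
      + d * + e            ∎
      where open ≡-Reasoning

  bézout : ∀ m n → ∃₂ λ α β → α * + m + β * + n ≡ + gcd m n
  bézout m n with Bézout.identity (gcd-GCD m n)
  ... | Bézout.+- x y eq =
    + x , - + y , trans (cong (_+ - + y * + n) (sym (lift (gcd m n) y n x m eq))) (cancel (+ gcd m n) (+ y) (+ n))
    where cancel : ∀ g y n → g + y * n + - y * n ≡ g
          cancel = solve-∀
  ... | Bézout.-+ x y eq =
    - + x , + y , trans (cong (λ w → - + x * + m + w) (sym (lift (gcd m n) x m y n eq))) (cancel (+ gcd m n) (+ x) (+ m))
    where cancel : ∀ g x m → - x * m + (g + x * m) ≡ g
          cancel = solve-∀

  record GcdCofactors (a b : ℤ) : Set where
    constructor cofactors
    field
      g     : ℕ
      α β   : ℤ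
      α-β   : α * a + β * b ≡ + g
      a′ b′ : ℤ
      a≡    : a ≡ a′ * + g
      b≡    : b ≡ b′ * + g

  gcd-cofactors : ∀ a b → GcdCofactors a b
  gcd-cofactors a b with bézout ∣ a ∣ ∣ b ∣ | m∣∣m∣ {a} | m∣∣m∣ {b}
                       | ∣ᵤ⇒∣ {+ gcd ∣ a ∣ ∣ b ∣} {a} (gcd[m,n]∣m ∣ a ∣ ∣ b ∣)
                       | ∣ᵤ⇒∣ {+ gcd ∣ a ∣ ∣ b ∣} {b} (gcd[m,n]∣n ∣ a ∣ ∣ b ∣)
  ... | α , β , eq | divides σa ∣a∣≡σa*a | divides σb ∣b∣≡σb*b | divides a′ a≡ | divides b′ b≡ =
    cofactors _ (α * σa) (β * σb) α-β a′ b′ a≡ b≡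
    where
    α-β : α * σa * a + β * σb * b ≡ + gcd ∣ a ∣ ∣ b ∣
    α-β = trans (cong₂ _+_ (ℤₚ.*-assoc α σa a) (ℤₚ.*-assoc β σb b))
                (trans (cong₂ (λ u v → α * u + β * v) (sym ∣a∣≡σa*a) (sym ∣b∣≡σb*b)) eq)

  bézout₃ : ∀ a b c → ∃₂ λ κ μ → ∃ λ ν → κ * + a + μ * + b + ν * + c ≡ + gcd (gcd a b) c
  bézout₃ a b c with bézout a b | bézout (gcd a b) c
  ... | α , β , eq₁ | γ , δ , eq₂ = γ * α , γ * β , δ , (begin
    γ * α * + a + γ * β * + b + δ * + c   ≡⟨ law γ α β δ (+ a) (+ b) (+ c) ⟩
    γ * (α * + a + β * + b) + δ * + c     ≡⟨ cong (λ z → γ * z + δ * + c) eq₁ ⟩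
    γ * + gcd a b + δ * + c               ≡⟨ eq₂ ⟩
    + gcd (gcd a b) c                     ∎)
    where
    open ≡-Reasoning
    law : ∀ γ α β δ a b c → γ * α * a + γ * β * b + δ * c ≡ γ * (α * a + β * b) + δ * c
    law = solve-∀

module Lattice where

  open Points
  open import Data.Integer using (+_; -_; _+_; _-_; _*_)
  open import Data.Integer.Divisibility.Signed using (_∣_; divides; ∣m∣n⇒∣m+n; ∣n⇒∣m*n; ∣-refl; ∣m⇒∣-m)
  open import Data.Integer.Tactic.RingSolver using (solve-∀; solve)
  open import Data.List using (_∷_; [])
  open import Data.Product using (_,_; _×_)
  open import Data.Product.Properties using (×-≡,≡→≡)
  open import Relation.Binary.PropositionalEquality using (_≡_; refl; subst)

  InΛ-⊖ : ∀ B {x y} → InΛ B x → InΛ B y → InΛ B (x ⊖ y)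
  InΛ-⊖ [ (a₁ , a₂) ∣ (b₁ , b₂) ] (m , n , refl) (m′ , n′ , refl) =
    m - m′ , n - n′ , ×-≡,≡→≡ (law m n m′ n′ a₁ b₁ , law m n m′ n′ a₂ b₂)
    where law : ∀ m n m′ n′ a b → (m * a + n * b) - (m′ * a + n′ * b) ≡ (m - m′) * a + (n - n′) * b
          law = solve-∀

  InΛ-⊆ : ∀ B B′ → InΛ B′ (col-a B) → InΛ B′ (col-b B) → ∀ {x} → InΛ B x → InΛ B′ x
  InΛ-⊆ [ _ ∣ _ ] [ (c₁ , c₂) ∣ (d₁ , d₂) ] (p , q , refl) (r , s , refl) (m , n , refl) =
    m * p + n * r , m * q + n * s , ×-≡,≡→≡ (law m n p q r s c₁ d₁ , law m n p q r s c₂ d₂)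
    where law : ∀ m n p q r s c d → m * (p * c + q * d) + n * (r * c + s * d) ≡ (m * p + n * r) * c + (m * q + n * s) * d
          law = solve-∀

  ∣∙-on-Λ : ∀ B {k} w {x} → k ∣ w ∙ col-a B → k ∣ w ∙ col-b B → InΛ B x → k ∣ w ∙ x
  ∣∙-on-Λ B w {x} k∣a k∣b (m , n , refl)
    rewrite ∙-distribˡ-⊕ w (m · col-a B) (n · col-b B) | ∙-·-comm w m (col-a B) | ∙-·-comm w n (col-b B)
    = ∣m∣n⇒∣m+n (∣n⇒∣m*n m k∣a) (∣n⇒∣m*n n k∣b)

  perp : Pt → Pt
  perp (x₁ , x₂) = (- x₂ , x₁)

  -- Cramer's rule: x = m a + n b has n = perp a ∙ x / det B and m = - perp b ∙ x / det B.
  perp-∣-on-Λ : ∀ B {x} → InΛ B x → det B ∣ perp (col-a B) ∙ x × det B ∣ perp (col-b B) ∙ x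
  perp-∣-on-Λ B@([ (a₁ , a₂) ∣ (b₁ , b₂) ]) x∈Λ =
    ∣∙-on-Λ B (perp (a₁ , a₂)) (divides (+ 0) pa∙a) (subst (det B ∣_) pa∙b ∣-refl) x∈Λ ,
    ∣∙-on-Λ B (perp (b₁ , b₂)) (subst (det B ∣_) pb∙a (∣m⇒∣-m ∣-refl)) (divides (+ 0) pb∙b) x∈Λ
    where
    pa∙a : - a₂ * a₁ + a₁ * a₂ ≡ + 0
    pa∙a = solve (a₁ ∷ a₂ ∷ [])
    pa∙b : a₁ * b₂ - a₂ * b₁ ≡ - a₂ * b₁ + a₁ * b₂
    pa∙b = solve (a₁ ∷ a₂ ∷ b₁ ∷ b₂ ∷ [])
    pb∙a : - (a₁ * b₂ - a₂ * b₁) ≡ - b₂ * a₁ + b₁ * a₂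
    pb∙a = solve (a₁ ∷ a₂ ∷ b₁ ∷ b₂ ∷ [])
    pb∙b : - b₂ * b₁ + b₁ * b₂ ≡ + 0
    pb∙b = solve (b₁ ∷ b₂ ∷ [])

module FinSums where

  open import Algebra.Bundles using (CommutativeMonoid)
  import Algebra.Properties.CommutativeMonoid.Sum as Sum
  open import Data.Fin using (Fin; zero; suc; punchOut)
  open import Data.Fin.Permutation using (Permutation; permutation)
  open import Data.Fin.Properties using (any?; _≟_; punchOut-injective; injective⇒≤)
  open import Data.Integer using (ℤ; +_)
  open import Data.Integer.Divisibility.Signed using (_∣_; divides; ∣m∣n⇒∣m+n)
  import Data.Integer.Properties as ℤₚ
  open import Data.Nat using (zero; suc)
  open import Data.Nat.Properties using (1+n≰n)
  open import Data.Product using (∃; _,_; proj₁; proj₂)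
  open import Function.Base using (_∘_)
  open import Function.Definitions using (Injective)
  open import Relation.Binary.PropositionalEquality using (_≡_; _≢_; refl; sym)
  open import Relation.Nullary using (yes; no)
  open import Relation.Nullary.Negation using (contradiction)

  injective⇒surjective : ∀ {n} (f : Fin n → Fin n) → Injective _≡_ _≡_ f → ∀ y → ∃ λ x → f x ≡ y
  injective⇒surjective {suc n} f f-inj y with any? (λ x → f x ≟ y)
  ... | yes hit = hit
  ... | no miss = contradiction (injective⇒≤ g-inj) 1+n≰n
    where
    f≢y : ∀ x → y ≢ f x
    f≢y x eq = miss (x , sym eq)
    g : Fin (suc n) → Fin n
    g x = punchOut (f≢y x)
    g-inj : Injective _≡_ _≡_ g
    g-inj eq = f-inj (punchOut-injective (f≢y _) (f≢y _) eq)

  injective⇒permutation : ∀ {n} (f : Fin n → Fin n) → Injective _≡_ _≡_ f → Permutation n n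
  injective⇒permutation f f-inj = permutation f (proj₁ ∘ surj) (proj₂ ∘ surj) (λ x → f-inj (proj₂ (surj (f x))))
    where surj = injective⇒surjective f f-inj

  module _ {c ℓ} (M : CommutativeMonoid c ℓ) where
    open CommutativeMonoid M using (_≈_) renaming (sym to ≈-sym)
    open Sum M using (sum; sum-permute)

    sum-∘-injective : ∀ {n} (F : Fin n → CommutativeMonoid.Carrier M) (f : Fin n → Fin n) →
                      Injective _≡_ _≡_ f → sum (F ∘ f) ≈ sum F
    sum-∘-injective F f f-inj = ≈-sym (sum-permute F (injective⇒permutation f f-inj))

  open Sum ℤₚ.+-0-commutativeMonoid using (sum)

  ∣-sum : ∀ {k n} (F : Fin n → ℤ) → (∀ i → k ∣ F i) → k ∣ sum F
  ∣-sum {n = zero} F _ = divides (+ 0) refl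
  ∣-sum {n = suc n} F k∣F = ∣m∣n⇒∣m+n (k∣F zero) (∣-sum (F ∘ suc) (k∣F ∘ suc))

module Transversals where

  open Points
  open Lattice
  open FinSums
  open IntegerArithmetic
  open import Algebra.Bundles using (CommutativeMonoid)
  import Algebra.Properties.CommutativeMonoid.Sum as Sum
  open import Data.Fin using (Fin; toℕ; fromℕ<; cast; combine; remQuot)
  open import Data.Fin.Properties using (toℕ-fromℕ<; toℕ-injective; toℕ<n; remQuot-combine; combine-remQuot; cast-involutive)
  open import Data.Integer using (ℤ; +_; -_; _+_; _-_; _*_; ∣_∣; 0ℤ; _%ℕ_; _/ℕ_)
  open import Data.Integer.DivMod using (a≡a%ℕn+[a/ℕn]*n; n%ℕd<d)
  open import Data.Integer.Divisibility.Signed using (divides; m∣∣m∣; ∣m∣∣m)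
  open import Data.Empty using (⊥-elim)
  import Data.Integer.Properties as ℤₚ
  open import Data.Integer.Tactic.RingSolver using (solve-∀)
  open import Data.List using (List; length; lookup; tabulate)
  open import Data.List.Properties using (length-tabulate; lookup-tabulate)
  open import Data.Nat as ℕ using (ℕ; NonZero)
  open import Data.Product using (Σ; ∃; _×_; _,_; proj₁; proj₂; uncurry)
  open import Data.Product.Properties using (×-≡,≡→≡; ×-≡,≡←≡)
  open import Function.Base using (_∘_)
  open import Function.Definitions using (Injective)
  open import Relation.Binary.PropositionalEquality

  InjectiveModΛ : Mat → (Pt → Pt) → Set
  InjectiveModΛ B g = ∀ x y → InΛ B (g x ⊖ g y) → InΛ B (x ⊖ y)

  module Classes (B : Mat) (xs : List Pt) (T : IsTransversal B xs) where

    classOf : Pt → Fin (length xs)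
    classOf x = proj₁ (proj₁ T x)

    ∈-classOf : ∀ x → InΛ B (x ⊖ lookup xs (classOf x))
    ∈-classOf x = proj₂ (proj₁ T x)

    classOf-injective : ∀ g → InjectiveModΛ B g → Injective _≡_ _≡_ (classOf ∘ g ∘ lookup xs)
    classOf-injective g g-inj {i} {j} same =
      proj₂ T i j (g-inj xᵢ xⱼ (subst (InΛ B) ([x⊖z]⊖[y⊖z]≡x⊖y (g xᵢ) (g xⱼ) y) difference))
      where
      xᵢ = lookup xs i
      xⱼ = lookup xs j
      y = lookup xs (classOf (g xᵢ))
      difference : InΛ B ((g xᵢ ⊖ y) ⊖ (g xⱼ ⊖ y))
      difference = InΛ-⊖ B (∈-classOf (g xᵢ)) (subst (λ k → InΛ B (g xⱼ ⊖ lookup xs k)) (sym same) (∈-classOf (g xⱼ)))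

    module _ {c ℓ} (M : CommutativeMonoid c ℓ) where
      open CommutativeMonoid M using (Carrier; _≈_) renaming (trans to ≈-trans)
      open Sum M using (sum; sum-cong-≋)

      sum-periodic-∘ : ∀ g (F : Pt → Carrier) → (∀ x y → InΛ B (x ⊖ y) → F x ≈ F y) → InjectiveModΛ B g →
                       sum (F ∘ g ∘ lookup xs) ≈ sum (F ∘ lookup xs)
      sum-periodic-∘ g F F-periodic g-inj =
        ≈-trans (sum-cong-≋ (λ i → F-periodic (g (lookup xs i)) _ (∈-classOf (g (lookup xs i)))))
                (sum-∘-injective M (F ∘ lookup xs) (classOf ∘ g ∘ lookup xs) (classOf-injective g g-inj))

  tabulate-transversal : ∀ B {n} (e : Fin n → Pt) → (∀ x → ∃ λ i → InΛ B (x ⊖ e i)) →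
                         (∀ i j → InΛ B (e i ⊖ e j) → i ≡ j) → IsTransversal B (tabulate e)
  tabulate-transversal B e complete distinct = covers , separates
    where
    len = length-tabulate e
    lookup≡e : ∀ k → lookup (tabulate e) k ≡ e (cast len k)
    lookup≡e k = trans (cong (lookup (tabulate e)) (sym (cast-involutive (sym len) len k))) (lookup-tabulate e (cast len k))
    covers : ∀ x → Σ (Fin (length (tabulate e))) λ k → InΛ B (x ⊖ lookup (tabulate e) k)
    covers x with complete x
    ... | i , x∈ = cast (sym len) i , subst (λ p → InΛ B (x ⊖ p)) (sym (lookup-tabulate e i)) x∈
    separates : ∀ k k′ → InΛ B (lookup (tabulate e) k ⊖ lookup (tabulate e) k′) → k ≡ k′
    separates k k′ k≈k′ = begin
      k                             ≡⟨ cast-involutive (sym len) len k ⟨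
      cast (sym len) (cast len k)   ≡⟨ cong (cast (sym len)) (distinct _ _ (subst₂ (λ p q → InΛ B (p ⊖ q)) (lookup≡e k) (lookup≡e k′) k≈k′)) ⟩
      cast (sym len) (cast len k′)  ≡⟨ cast-involutive (sym len) len k′ ⟩
      k′                            ∎
      where open ≡-Reasoning

  module HermiteBox (g M : ℕ) .{{_ : NonZero g}} .{{_ : NonZero M}} (s : ℤ) where

    H : Mat
    H = [ (+ g , s) ∣ (+ 0 , + M) ]

    corner : Fin g × Fin M → Pt
    corner (i , j) = (+ toℕ i , + toℕ j)

    corner-complete : ∀ x → ∃ λ ij → InΛ H (x ⊖ corner ij)
    corner-complete (x₁ , x₂) =
      (fromℕ< (n%ℕd<d x₁ g) , fromℕ< (n%ℕd<d y M)) , q₁ , q₂ , ×-≡,≡→≡ (first , second)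
      where
      q₁ = x₁ /ℕ g
      y = x₂ - q₁ * s
      q₂ = y /ℕ M
      first : x₁ - + toℕ (fromℕ< (n%ℕd<d x₁ g)) ≡ q₁ * + g + q₂ * + 0
      first = begin
        x₁ - + toℕ (fromℕ< (n%ℕd<d x₁ g)) ≡⟨ cong (λ r → x₁ - + r) (toℕ-fromℕ< (n%ℕd<d x₁ g)) ⟩
        x₁ - + (x₁ %ℕ g)                   ≡⟨ x≡r+q⇒x-r≡q (a≡a%ℕn+[a/ℕn]*n x₁ g) ⟩
        q₁ * + g                           ≡⟨ ℤₚ.+-identityʳ (q₁ * + g) ⟨
        q₁ * + g + 0ℤ                      ≡⟨ cong (λ z → q₁ * + g + z) (ℤₚ.*-zeroʳ q₂) ⟨
        q₁ * + g + q₂ * + 0                ∎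
        where open ≡-Reasoning
      second : x₂ - + toℕ (fromℕ< (n%ℕd<d y M)) ≡ q₁ * s + q₂ * + M
      second = begin
        x₂ - + toℕ (fromℕ< (n%ℕd<d y M)) ≡⟨ cong (λ r → x₂ - + r) (toℕ-fromℕ< (n%ℕd<d y M)) ⟩
        x₂ - + (y %ℕ M)                   ≡⟨ regroup x₂ (q₁ * s) (+ (y %ℕ M)) ⟩
        q₁ * s + (y - + (y %ℕ M))          ≡⟨ cong (λ z → q₁ * s + z) (x≡r+q⇒x-r≡q (a≡a%ℕn+[a/ℕn]*n y M)) ⟩
        q₁ * s + q₂ * + M                  ∎
        where
        open ≡-Reasoning
        regroup : ∀ x a r → x - r ≡ a + (x - a - r)
        regroup = solve-∀

    corner-distinct : ∀ ij ij′ → InΛ H (corner ij ⊖ corner ij′) → ij ≡ ij′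
    corner-distinct (i , j) (i′ , j′) (μ , ν , eq) = cong₂ _,_ (toℕ-injective i≡i′) (toℕ-injective j≡j′)
      where
      open ≡-Reasoning
      di : + toℕ i - + toℕ i′ ≡ μ * + g
      di = begin
        + toℕ i - + toℕ i′    ≡⟨ proj₁ (×-≡,≡←≡ eq) ⟩
        μ * + g + ν * + 0      ≡⟨ cong (λ z → μ * + g + z) (ℤₚ.*-zeroʳ ν) ⟩
        μ * + g + 0ℤ           ≡⟨ ℤₚ.+-identityʳ (μ * + g) ⟩
        μ * + g                ∎
      i≡i′ = multiple<bound⇒≡ μ (toℕ<n i) (toℕ<n i′) di
      dj : + toℕ j - + toℕ j′ ≡ ν * + M
      dj = begin
        + toℕ j - + toℕ j′    ≡⟨ proj₂ (×-≡,≡←≡ eq) ⟩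
        μ * s + ν * + M        ≡⟨ cong (λ m → m * s + ν * + M) (multiple<bound⇒0 μ (toℕ<n i) (toℕ<n i′) di) ⟩
        0ℤ + ν * + M           ≡⟨ ℤₚ.+-identityˡ (ν * + M) ⟩
        ν * + M                ∎
      j≡j′ = multiple<bound⇒≡ ν (toℕ<n j) (toℕ<n j′) dj

    box : List Pt
    box = tabulate (corner ∘ remQuot {g} M)

    box-transversal : IsTransversal H box
    box-transversal = tabulate-transversal H (corner ∘ remQuot {g} M) complete distinct
      where
      complete : ∀ x → ∃ λ k → InΛ H (x ⊖ corner (remQuot {g} M k))
      complete x with corner-complete x
      ... | (i , j) , x∈ = combine i j , subst (λ ij → InΛ H (x ⊖ corner ij)) (sym (remQuot-combine i j)) x∈
      distinct : ∀ k k′ → InΛ H (corner (remQuot {g} M k) ⊖ corner (remQuot {g} M k′)) → k ≡ k′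
      distinct k k′ k≈k′ = begin
        k                                   ≡⟨ combine-remQuot {g} M k ⟨
        uncurry combine (remQuot {g} M k)   ≡⟨ cong (uncurry combine) (corner-distinct (remQuot {g} M k) (remQuot {g} M k′) k≈k′) ⟩
        uncurry combine (remQuot {g} M k′)  ≡⟨ combine-remQuot {g} M k′ ⟩
        k′                                  ∎
        where open ≡-Reasoning

  IsTransversal-resp : ∀ {B B′ xs} → (∀ {x} → InΛ B x → InΛ B′ x) → (∀ {x} → InΛ B′ x → InΛ B x) →
                       IsTransversal B xs → IsTransversal B′ xs
  IsTransversal-resp B⊆B′ B′⊆B (covers , separates) =
    (λ x → proj₁ (covers x) , B⊆B′ (proj₂ (covers x))) , (λ i j → separates i j ∘ B′⊆B)

  -- Hermite normal form: with g = gcd(a₁, b₁) = α a₁ + β b₁, the lattice of B is spanned by (g, α a₂ + β b₂) and (0, |t|).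
  module HermiteReduction (a′ b′ a₂ b₂ α β : ℤ) (g : ℕ) .{{_ : NonZero g}}
                          (α-β : α * (a′ * + g) + β * (b′ * + g) ≡ + g)
                          (det≢0 : det [ (a′ * + g , a₂) ∣ (b′ * + g , b₂) ] ≢ 0ℤ) where

    B : Mat
    B = [ (a′ * + g , a₂) ∣ (b′ * + g , b₂) ]

    unit : α * a′ + β * b′ ≡ + 1
    unit = ℤₚ.*-cancelˡ-≡ (+ g) _ _ (trans (factor α β a′ b′ (+ g)) (trans α-β (sym (ℤₚ.*-identityʳ (+ g)))))
      where factor : ∀ α β a b g → g * (α * a + β * b) ≡ α * (a * g) + β * (b * g)
            factor = solve-∀

    s t : ℤ
    s = α * a₂ + β * b₂
    t = b′ * a₂ - a′ * b₂

    det≡ : det B ≡ - (+ g * t)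
    det≡ = law a′ b′ a₂ b₂ (+ g)
      where law : ∀ a b a₂ b₂ g → a * g * b₂ - a₂ * (b * g) ≡ - (g * (b * a₂ - a * b₂))
            law = solve-∀

    M : ℕ
    M = ∣ t ∣

    instance
      M≢0 : NonZero M
      M≢0 = ℕ.≢-nonZero (λ ∣t∣≡0 → det≢0 (trans det≡ (trans (cong (λ z → - (+ g * z)) (ℤₚ.∣i∣≡0⇒i≡0 ∣t∣≡0)) (cong -_ (ℤₚ.*-zeroʳ (+ g))))))

    open HermiteBox g M s

    column∈H : ∀ c′ c₂ κ → c₂ ≡ c′ * s + κ * t → InΛ H (c′ * + g , c₂)
    column∈H c′ c₂ κ c₂≡ with ∣m∣∣m {t}
    ... | divides τ t≡τM = c′ , κ * τ , ×-≡,≡→≡ (sym (pad (c′ * + g) (κ * τ)) , second)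
      where
      pad : ∀ x y → x + y * + 0 ≡ x
      pad = solve-∀
      second : c₂ ≡ c′ * s + κ * τ * + M
      second = trans c₂≡ (trans (cong (λ z → c′ * s + κ * z) t≡τM) (cong (λ z → c′ * s + z) (sym (ℤₚ.*-assoc κ τ (+ M)))))

    ×unit : ∀ c → c ≡ c * (α * a′ + β * b′)
    ×unit c = trans (sym (ℤₚ.*-identityʳ c)) (cong (c *_) (sym unit))

    a∈H : InΛ H (col-a B)
    a∈H = column∈H a′ a₂ β (trans (×unit a₂) (law a′ b′ a₂ b₂ α β))
      where law : ∀ a′ b′ a₂ b₂ α β → a₂ * (α * a′ + β * b′) ≡ a′ * (α * a₂ + β * b₂) + β * (b′ * a₂ - a′ * b₂)
            law = solve-∀

    b∈H : InΛ H (col-b B)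
    b∈H = column∈H b′ b₂ (- α) (trans (×unit b₂) (law a′ b′ a₂ b₂ α β))
      where law : ∀ a′ b′ a₂ b₂ α β → b₂ * (α * a′ + β * b′) ≡ b′ * (α * a₂ + β * b₂) + - α * (b′ * a₂ - a′ * b₂)
            law = solve-∀

    g,s∈B : InΛ B (col-a H)
    g,s∈B = α , β , ×-≡,≡→≡ (sym α-β , refl)

    0,M∈B : InΛ B (col-b H)
    0,M∈B with m∣∣m∣ {t}
    ... | divides σ M≡σt = σ * b′ , - (σ * a′) , ×-≡,≡→≡ (first σ a′ b′ (+ g) , trans M≡σt (second σ a′ b′ a₂ b₂))
      where
      first : ∀ σ a′ b′ g → + 0 ≡ σ * b′ * (a′ * g) + - (σ * a′) * (b′ * g)
      first = solve-∀
      second : ∀ σ a′ b′ a₂ b₂ → σ * (b′ * a₂ - a′ * b₂) ≡ σ * b′ * a₂ + - (σ * a′) * b₂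
      second = solve-∀

    index≡ : g ℕ.* M ≡ index B
    index≡ = begin
      g ℕ.* ∣ t ∣        ≡⟨ ℤₚ.abs-* (+ g) t ⟨
      ∣ + g * t ∣        ≡⟨ ℤₚ.∣-i∣≡∣i∣ (+ g * t) ⟨
      ∣ - (+ g * t) ∣    ≡⟨ cong ∣_∣ det≡ ⟨
      ∣ det B ∣          ∎
      where open ≡-Reasoning

    transversal : ∃ λ xs → IsTransversal B xs × length xs ≡ index B
    transversal = box ,
                  IsTransversal-resp {xs = box} (InΛ-⊆ H B g,s∈B 0,M∈B) (InΛ-⊆ B H a∈H b∈H) box-transversal ,
                  trans (length-tabulate (corner ∘ remQuot {g} M)) index≡

  transversal-exists : ∀ B → det B ≢ 0ℤ → ∃ λ xs → IsTransversal B xs × length xs ≡ index B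
  transversal-exists [ (a₁ , a₂) ∣ (b₁ , b₂) ] det≢0 with gcd-cofactors a₁ b₁
  ... | cofactors ℕ.zero _ _ _ a′ b′ refl refl = ⊥-elim (det≢0 (law a′ b′ a₂ b₂))
    where law : ∀ a′ b′ a₂ b₂ → a′ * + 0 * b₂ - a₂ * (b′ * + 0) ≡ + 0
          law = solve-∀
  ... | cofactors g@(ℕ.suc _) α β α-β a′ b′ refl refl = HermiteReduction.transversal a′ b′ a₂ b₂ α β g α-β det≢0

module Necessity where

  open Points
  open Lattice
  open FinSums
  open Transversals
  import Algebra.Properties.CommutativeMonoid.Sum as Sum
  open import Data.Fin using (Fin)
  open import Data.Integer using (ℤ; +_; -_; _+_; _-_; _*_)
  open import Data.Integer.Divisibility.Signed using (_∣_)
  import Data.Integer.Properties as ℤₚ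
  open import Data.Integer.Tactic.RingSolver using (solve-∀)
  open import Data.List using (List; []; _∷_; length; lookup; map)
  open import Data.Nat using (ℕ)
  open import Data.Product using (_×_; _,_; proj₁; proj₂)
  open import Function.Base using (_∘_)
  open import Relation.Binary.PropositionalEquality

  open import Algebra.Properties.AbelianGroup ℤₚ.+-0-abelianGroup using () renaming (∙-cancelʳ to +-cancelʳ)
  open Sum ℤₚ.+-0-commutativeMonoid using (sum; sum-cong-≗; ∑-distrib-+)

  shift : (Pt → Tile) → Pt → Pt
  shift τ x = x ⊕ ξ (τ x)

  shift-injectiveModΛ : ∀ {B τ} → IsTiling B τ → InjectiveModΛ B (shift τ)
  shift-injectiveModΛ {B} {τ} (periodic , injective , _) x y diff∈Λ =
    subst (InΛ B) (trans (sym ([x⊕y]⊖x≡y y l)) (cong (_⊖ y) (injective {y ⊕ l} {x} lands-on-x))) diff∈Λ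
    where
    l = shift τ x ⊖ shift τ y
    lands-on-x : shift τ (y ⊕ l) ≡ shift τ x
    lands-on-x = trans (cong (λ t → (y ⊕ l) ⊕ ξ t) (periodic y l diff∈Λ)) ([y⊕[p⊖[y⊕q]]]⊕q≡p y (shift τ x) (ξ (τ y)))

  module _ {B τ xs} (T : IsTransversal B xs) (tiling : IsTiling B τ) where
    open Classes B xs T

    -- Summing x ↦ w ∙ (shift τ x - x) over a transversal telescopes, up to lattice vectors.
    ∣-sum-ξ : ∀ {k} w → (∀ {x} → InΛ B x → k ∣ w ∙ x) → k ∣ sum (λ i → w ∙ ξ (τ (lookup xs i)))
    ∣-sum-ξ {k} w k∣Λ = subst (k ∣_) (sym sums) (∣-sum E (λ i → k∣Λ (∈-classOf (shift τ (X i)))))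
      where
      open ≡-Reasoning
      X = lookup xs
      π = classOf ∘ shift τ ∘ X
      Ξ E W : Fin (length xs) → ℤ
      Ξ i = w ∙ ξ (τ (X i))
      E i = w ∙ (shift τ (X i) ⊖ X (π i))
      W i = w ∙ X i
      pointwise : ∀ i → Ξ i + W i ≡ E i + W (π i)
      pointwise i = sym (begin
        E i + W (π i)                          ≡⟨ cong (_+ W (π i)) (∙-distribˡ-⊖ w (shift τ (X i)) (X (π i))) ⟩
        w ∙ shift τ (X i) - W (π i) + W (π i)  ≡⟨ cong (λ z → z - W (π i) + W (π i)) (∙-distribˡ-⊕ w (X i) (ξ (τ (X i)))) ⟩
        W i + Ξ i - W (π i) + W (π i)          ≡⟨ law (W i) (Ξ i) (W (π i)) ⟩
        Ξ i + W i                              ∎)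
        where law : ∀ a b c → a + b - c + c ≡ b + a
              law = solve-∀
      sums : sum Ξ ≡ sum E
      sums = +-cancelʳ (sum W) (sum Ξ) (sum E) (begin
        sum Ξ + sum W              ≡⟨ ∑-distrib-+ Ξ W ⟨
        sum (λ i → Ξ i + W i)      ≡⟨ sum-cong-≗ pointwise ⟩
        sum (λ i → E i + W (π i))  ≡⟨ ∑-distrib-+ E (W ∘ π) ⟩
        sum E + sum (W ∘ π)        ≡⟨ cong (λ z → sum E + z) (sum-∘-injective ℤₚ.+-0-commutativeMonoid W π π-injective) ⟩
        sum E + sum W              ∎)
        where π-injective = classOf-injective (shift τ) (shift-injectiveModΛ tiling)

  weigh : (Tile → ℤ) → List Tile → ℤ
  weigh H ts = + count L ts * H L + + count D ts * H D + + count R ts * H R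

  weigh-∷ : ∀ H t ts → weigh H (t ∷ ts) ≡ H t + weigh H ts
  weigh-∷ H L ts = law (H L) (H D) (H R) (+ count L ts) (+ count D ts) (+ count R ts)
    where law : ∀ l d r cl cd cr → (+ 1 + cl) * l + cd * d + cr * r ≡ l + (cl * l + cd * d + cr * r)
          law = solve-∀
  weigh-∷ H D ts = law (H L) (H D) (H R) (+ count L ts) (+ count D ts) (+ count R ts)
    where law : ∀ l d r cl cd cr → cl * l + (+ 1 + cd) * d + cr * r ≡ d + (cl * l + cd * d + cr * r)
          law = solve-∀
  weigh-∷ H R ts = law (H L) (H D) (H R) (+ count L ts) (+ count D ts) (+ count R ts)
    where law : ∀ l d r cl cd cr → cl * l + cd * d + (+ 1 + cr) * r ≡ r + (cl * l + cd * d + cr * r)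
          law = solve-∀

  sum-tiles : ∀ (H : Tile → ℤ) (τ : Pt → Tile) xs → sum (λ i → H (τ (lookup xs i))) ≡ weigh H (map τ xs)
  sum-tiles H τ []       = refl
  sum-tiles H τ (x ∷ xs) = trans (cong (λ z → H (τ x) + z) (sum-tiles H τ xs)) (sym (weigh-∷ H (τ x) (map τ xs)))

  -- Orthogonal to the total displacement nL ξ(L) + nR ξ(R) of a tiling of type (nL, nD, nR).
  typeNormal : ℕ → ℕ → Pt
  typeNormal nL nR = (+ nL + + nR , + nL)

  weigh-perp : ∀ c ts → weigh (λ t → perp c ∙ ξ t) ts ≡ typeNormal (count L ts) (count R ts) ∙ c
  weigh-perp (c₁ , c₂) ts = law c₁ c₂ (+ count L ts) (+ count D ts) (+ count R ts)
    where law : ∀ c₁ c₂ l d r → l * (- c₂ * - + 1 + c₁ * + 1) + d * (- c₂ * + 0 + c₁ * + 0) + r * (- c₂ * + 0 + c₁ * + 1)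
                                ≡ (l + r) * c₁ + l * c₂
          law = solve-∀

  TypeDivisible : ℤ → Mat → ℕ → ℕ → Set
  TypeDivisible n B nL nR = n ∣ typeNormal nL nR ∙ col-a B × n ∣ typeNormal nL nR ∙ col-b B

  tiling⇒TypeDivisible : ∀ {B τ nL nD nR} → IsTiling B τ → HasType B τ nL nD nR → TypeDivisible (det B) B nL nR
  tiling⇒TypeDivisible {B} {τ} tiling (xs , T , refl , _ , refl) =
    along (col-a B) (proj₁ ∘ perp-∣-on-Λ B) , along (col-b B) (proj₂ ∘ perp-∣-on-Λ B)
    where
    along : ∀ c → (∀ {x} → InΛ B x → det B ∣ perp c ∙ x) →
            det B ∣ typeNormal (count L (map τ xs)) (count R (map τ xs)) ∙ c
    along c det∣ = subst (det B ∣_) (trans (sum-tiles (λ t → perp c ∙ ξ t) τ xs) (weigh-perp c (map τ xs)))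
                                    (∣-sum-ξ {xs = xs} T tiling (perp c) det∣)

module CosetCondition where

  open Points
  open Heights
  open Necessity using (typeNormal; TypeDivisible)
  open import Data.Integer using (ℤ; +_; -_; _+_; _-_; _*_; 0ℤ)
  open import Data.Integer.Divisibility.Signed using (divides)
  import Data.Integer.Properties as ℤₚ
  open import Data.Integer.Tactic.RingSolver using (solve-∀)
  open import Data.Nat as ℕ using (ℕ)
  open import Data.Product using (_×_; _,_)
  open import Data.Product.Properties using (×-≡,≡→≡; ×-≡,≡←≡)
  open import Function.Bundles using (_⇔_; mk⇔; Equivalence)
  open IntegerArithmetic using (x-y≡x⇒y≡0)
  open import Relation.Binary.PropositionalEquality

  module _ (nL nD nR : ℕ) where

    N : ℤ
    N = + (nL ℕ.+ nD ℕ.+ nR)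

    coset-defect : ∀ c k → + nL * height L c + + nD * height D c + + nR * height R c
                           ≡ N * (height D c + + 3 * k) - + 3 * (typeNormal nL nR ∙ c + k * N)
    coset-defect (c₁ , c₂) k = law (+ nL) (+ nD) (+ nR) c₁ c₂ k
      where
      law : ∀ l d r c₁ c₂ k → l * (- + 1 * c₁ + - + 2 * c₂) + d * (+ 2 * c₁ + + 1 * c₂) + r * (- + 1 * c₁ + + 1 * c₂)
                              ≡ (l + d + r) * (+ 2 * c₁ + + 1 * c₂ + + 3 * k) - + 3 * ((l + r) * c₁ + l * c₂ + k * (l + d + r))
      law = solve-∀

    coset-component : ∀ c k → (+ nL * height L c + + nD * height D c + + nR * height R c ≡ N * (height D c + + 3 * k))
                              ⇔ (typeNormal nL nR ∙ c ≡ - k * N)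
    coset-component c k = mk⇔ to from
      where
      combination A Z : ℤ
      combination = + nL * height L c + + nD * height D c + + nR * height R c
      A = N * (height D c + + 3 * k)
      Z = typeNormal nL nR ∙ c + k * N
      to : combination ≡ A → typeNormal nL nR ∙ c ≡ - k * N
      to eq = trans (law (typeNormal nL nR ∙ c) (k * N)) (trans (cong (_- k * N) Z≡0) (trans (ℤₚ.+-identityˡ (- (k * N))) (ℤₚ.neg-distribˡ-* k N)))
        where
        Z≡0 : Z ≡ 0ℤ
        Z≡0 = ℤₚ.*-cancelˡ-≡ (+ 3) Z 0ℤ (x-y≡x⇒y≡0 A (+ 3 * Z) (trans (sym (coset-defect c k)) eq))
        law : ∀ x y → x ≡ x + y - y
        law = solve-∀
      from : typeNormal nL nR ∙ c ≡ - k * N → combination ≡ A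
      from eq = trans (coset-defect c k) (trans (cong (λ z → A - + 3 * z) Z≡0) (ℤₚ.+-identityʳ A))
        where
        Z≡0 : Z ≡ 0ℤ
        Z≡0 = trans (cong (_+ k * N) (trans eq (sym (ℤₚ.neg-distribˡ-* k N)))) (ℤₚ.+-inverseˡ (k * N))

    InCoset⇔TypeDivisible : ∀ B {ΔL ΔD ΔR n} →
      Fingerprint (constTiling L) B ΔL → Fingerprint (constTiling D) B ΔD → Fingerprint (constTiling R) B ΔR →
      nL ℕ.+ nD ℕ.+ nR ≡ n → InCoset n nL nD nR ΔL ΔD ΔR ⇔ TypeDivisible (+ n) B nL nR
    InCoset⇔TypeDivisible B fL fD fR refl
      with fingerprint-const L B fL | fingerprint-const D B fD | fingerprint-const R B fR
    ... | refl | refl | refl = mk⇔ to from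
      where
      Coset : Set
      Coset = InCoset (nL ℕ.+ nD ℕ.+ nR) nL nD nR (constFingerprint L B) (constFingerprint D B) (constFingerprint R B)
      to : Coset → TypeDivisible N B nL nR
      to ((k₁ , k₂) , eq) with ×-≡,≡←≡ eq
      ... | eq₁ , eq₂ = divides (- k₁) (Equivalence.to (coset-component (col-a B) k₁) eq₁) ,
                        divides (- k₂) (Equivalence.to (coset-component (col-b B) k₂) eq₂)
      from : TypeDivisible N B nL nR → Coset
      from (divides q₁ eq₁ , divides q₂ eq₂) =
        (- q₁ , - q₂) , ×-≡,≡→≡ (Equivalence.from (coset-component (col-a B) (- q₁)) (trans eq₁ (cong (_* N) (sym (ℤₚ.neg-involutive q₁)))) ,
                                 Equivalence.from (coset-component (col-b B) (- q₂)) (trans eq₂ (cong (_* N) (sym (ℤₚ.neg-involutive q₂)))))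

module IntervalExchange where

  open import Data.Empty using (⊥; ⊥-elim)
  open import Data.Integer using (ℤ; +_; -_; _+_; 0ℤ)
  import Data.Integer.Properties as ℤₚ
  open import Data.Integer.Tactic.RingSolver using (solve-∀)
  open import Data.Nat as ℕ using (ℕ; _<_; _<?_; _∸_)
  import Data.Nat.Properties as ℕₚ
  open import Data.Product using (Σ; _,_; proj₁; proj₂)
  open import Relation.Binary.PropositionalEquality
  open import Relation.Nullary using (yes; no)

  data Part : Set where
    ① ② ③ : Part

  data Cut (a b c : ℕ) (s : ℕ) : Set where
    first  : s < a → Cut a b c s
    second : ∀ k → s ≡ a ℕ.+ k → k < b → Cut a b c s
    third  : ∀ k → s ≡ a ℕ.+ b ℕ.+ k → k < c → Cut a b c s

  part : ∀ {a b c s} → Cut a b c s → Part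
  part (first _)      = ①
  part (second _ _ _) = ②
  part (third _ _ _)  = ③

  cut : ∀ a b c s → s < a ℕ.+ b ℕ.+ c → Cut a b c s
  cut a b c s s<a+b+c with s <? a
  ... | yes s<a = first s<a
  ... | no s≮a with s ∸ a <? b
  ...   | yes k<b = second (s ∸ a) (sym (ℕₚ.m+[n∸m]≡n (ℕₚ.≮⇒≥ s≮a))) k<b
  ...   | no k≮b = third k s≡ (ℕₚ.+-cancelˡ-< (a ℕ.+ b) k c (subst (_< a ℕ.+ b ℕ.+ c) s≡ s<a+b+c))
    where
    k = s ∸ a ∸ b
    s≡ : s ≡ a ℕ.+ b ℕ.+ k
    s≡ = begin
      s                  ≡⟨ ℕₚ.m+[n∸m]≡n (ℕₚ.≮⇒≥ s≮a) ⟨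
      a ℕ.+ (s ∸ a)      ≡⟨ cong (a ℕ.+_) (ℕₚ.m+[n∸m]≡n (ℕₚ.≮⇒≥ k≮b)) ⟨
      a ℕ.+ (b ℕ.+ k)    ≡⟨ ℕₚ.+-assoc a b k ⟨
      a ℕ.+ b ℕ.+ k      ∎
      where open ≡-Reasoning

  private
    ≮-+ : ∀ {a k s} → s < a → s ≡ a ℕ.+ k → ⊥
    ≮-+ {a} {k} s<a refl = ℕₚ.<⇒≱ s<a (ℕₚ.m≤m+n a k)

    ≮-+-+ : ∀ {a b k s} → s < a → s ≡ a ℕ.+ b ℕ.+ k → ⊥
    ≮-+-+ {a} {b} {k} s<a s≡ = ≮-+ s<a (trans s≡ (ℕₚ.+-assoc a b k))

    ≮-+-cancel : ∀ {a b k k′} → k < b → a ℕ.+ k ≡ a ℕ.+ b ℕ.+ k′ → ⊥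
    ≮-+-cancel {a} {b} {k} {k′} k<b eq = ≮-+ k<b (ℕₚ.+-cancelˡ-≡ a k (b ℕ.+ k′) (trans eq (ℕₚ.+-assoc a b k′)))

  cut-unique : ∀ {a b c s s′} → s ≡ s′ → (p : Cut a b c s) (q : Cut a b c s′) → part p ≡ part q
  cut-unique refl (first _)         (first _)         = refl
  cut-unique refl (second _ _ _)    (second _ _ _)    = refl
  cut-unique refl (third _ _ _)     (third _ _ _)     = refl
  cut-unique refl (first s<a)       (second _ s≡ _)   = ⊥-elim (≮-+ s<a s≡)
  cut-unique refl (second _ s≡ _)   (first s<a)       = ⊥-elim (≮-+ s<a s≡)
  cut-unique refl (first s<a)       (third _ s≡ _)    = ⊥-elim (≮-+-+ s<a s≡)
  cut-unique refl (third _ s≡ _)    (first s<a)       = ⊥-elim (≮-+-+ s<a s≡)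
  cut-unique refl (second _ s≡ k<b) (third _ s≡′ _)   = ⊥-elim (≮-+-cancel k<b (trans (sym s≡) s≡′))
  cut-unique refl (third _ s≡′ _)   (second _ s≡ k<b) = ⊥-elim (≮-+-cancel k<b (trans (sym s≡) s≡′))

  flip : Part → Part
  flip ① = ①
  flip ② = ③
  flip ③ = ②

  flip-involutive : ∀ p → flip (flip p) ≡ p
  flip-involutive ① = refl
  flip-involutive ② = refl
  flip-involutive ③ = refl

  exchange : ∀ {a b c s} → Cut a b c s → Σ ℕ (Cut a c b)
  exchange {s = s} (first s<a)              = s , first s<a
  exchange {a} {c = c} (second k _ k<b)     = a ℕ.+ c ℕ.+ k , third k refl k<b
  exchange {a} (third k _ k<c)              = a ℕ.+ k , second k refl k<c

  part-exchange : ∀ {a b c s} (z : Cut a b c s) → part (proj₂ (exchange z)) ≡ flip (part z)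
  part-exchange (first _)      = refl
  part-exchange (second _ _ _) = refl
  part-exchange (third _ _ _)  = refl

  displacement : ℕ → ℕ → Part → ℤ
  displacement b c ① = 0ℤ
  displacement b c ② = + c
  displacement b c ③ = - + b

  exchange-displacement : ∀ {a b c s} (z : Cut a b c s) → + s + displacement b c (part z) ≡ + proj₁ (exchange z)
  exchange-displacement {s = s} (first _)             = ℤₚ.+-identityʳ (+ s)
  exchange-displacement {a} {c = c} (second k refl _) = law (+ a) (+ k) (+ c)
    where law : ∀ a k c → a + k + c ≡ a + c + k
          law = solve-∀
  exchange-displacement {a} {b} (third k refl _)     = law (+ a) (+ b) (+ k)
    where law : ∀ a b k → a + b + k + - b ≡ a + k
          law = solve-∀

  a+b+c≡a+c+b : ∀ a b c → a ℕ.+ b ℕ.+ c ≡ a ℕ.+ c ℕ.+ b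
  a+b+c≡a+c+b a b c = trans (ℕₚ.+-assoc a b c) (trans (cong (a ℕ.+_) (ℕₚ.+-comm b c)) (sym (ℕₚ.+-assoc a c b)))

  cut< : ∀ {a b c s} → Cut a b c s → s < a ℕ.+ b ℕ.+ c
  cut< {a} {b} {c} (first s<a)         = ℕₚ.<-≤-trans s<a (ℕₚ.≤-trans (ℕₚ.m≤m+n a b) (ℕₚ.m≤m+n (a ℕ.+ b) c))
  cut< {a} {b} {c} (second k refl k<b) = ℕₚ.<-≤-trans (ℕₚ.+-monoʳ-< a k<b) (ℕₚ.m≤m+n (a ℕ.+ b) c)
  cut< {a} {b} {c} (third k refl k<c)  = ℕₚ.+-monoʳ-< (a ℕ.+ b) k<c

  exchange< : ∀ {a b c s} (z : Cut a b c s) → proj₁ (exchange z) < a ℕ.+ b ℕ.+ c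
  exchange< {a} {b} {c} z = subst (proj₁ (exchange z) <_) (a+b+c≡a+c+b a c b) (cut< (proj₂ (exchange z)))

module ResidueTiling (Dp Rp Lp : ℕ) .{{_ : NonZero (Dp Data.Nat.+ Rp Data.Nat.+ Lp)}} where

  open import Data.Nat as ℕ using (ℕ; NonZero)

  open Points
  open IntegerArithmetic
  open IntervalExchange
  open Necessity using (shift; typeNormal)
  open import Data.Integer using (ℤ; +_; -_; _+_; _*_; 0ℤ; _%ℕ_; _/ℕ_)
  open import Data.Integer.DivMod using (a≡a%ℕn+[a/ℕn]*n; n%ℕd<d)
  open import Data.Integer.Divisibility.Signed using (_∣_; divides)
  import Data.Integer.Properties as ℤₚ
  open import Data.Integer.Tactic.RingSolver using (solve-∀)
  import Data.Nat.Properties as ℕₚ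
  open import Data.Product using (_,_; proj₁; proj₂)
  open import Data.Sum using (inj₁; inj₂)
  open import Data.List using (List; []; _∷_; length; lookup; map)
  open Transversals using (InjectiveModΛ; module Classes)
  import Algebra.Properties.CommutativeMonoid.Sum as Sum
  open import Function.Definitions using (Injective; Surjective)
  open import Data.Bool using (Bool; true; false; T)
  open import Data.Empty using (⊥-elim)
  open import Relation.Nullary using (¬_)
  open import Relation.Binary.PropositionalEquality

  Np : ℕ
  Np = Dp ℕ.+ Rp ℕ.+ Lp

  open Sum ℕₚ.+-0-commutativeMonoid using (sum; sum-cong-≗; ∑-distrib-+; sum-replicate-zero)

  φ : Pt → ℤ
  φ x = typeNormal Lp Rp ∙ x

  residue : Pt → ℕ
  residue x = φ x %ℕ Np

  residue-step : ∀ x z δ m {s} → s ℕ.< Np → φ z ≡ φ x + δ → + residue x + δ ≡ + s + m * + Np → residue z ≡ s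
  residue-step x z δ m {s} s<Np φz≡ r+δ≡ = %ℕ-unique (φ z) (m + φ x /ℕ Np) Np s<Np (begin
    φ z                                    ≡⟨ φz≡ ⟩
    φ x + δ                                ≡⟨ cong (_+ δ) (a≡a%ℕn+[a/ℕn]*n (φ x) Np) ⟩
    + residue x + φ x /ℕ Np * + Np + δ     ≡⟨ swap (+ residue x) (φ x /ℕ Np * + Np) δ ⟩
    + residue x + δ + φ x /ℕ Np * + Np     ≡⟨ cong (_+ φ x /ℕ Np * + Np) r+δ≡ ⟩
    + s + m * + Np + φ x /ℕ Np * + Np      ≡⟨ collect (+ s) m (φ x /ℕ Np) (+ Np) ⟩
    + s + (m + φ x /ℕ Np) * + Np           ∎)
    where
    open ≡-Reasoning
    swap : ∀ a b c → a + b + c ≡ a + c + b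
    swap = solve-∀
    collect : ∀ s m q n → s + m * n + q * n ≡ s + (m + q) * n
    collect = solve-∀

  residue-step₀ : ∀ x z δ {s} → s ℕ.< Np → φ z ≡ φ x + δ → + residue x + δ ≡ + s → residue z ≡ s
  residue-step₀ x z δ {s} s<Np φz≡ r+δ≡ = residue-step x z δ 0ℤ s<Np φz≡ (trans r+δ≡ (sym (ℤₚ.+-identityʳ (+ s))))

  zoneLabel imageLabel : Part → Tile
  zoneLabel ① = D
  zoneLabel ② = R
  zoneLabel ③ = L
  imageLabel ① = D
  imageLabel ② = L
  imageLabel ③ = R

  zoneLabel∘flip : ∀ p → zoneLabel (flip p) ≡ imageLabel p
  zoneLabel∘flip ① = refl
  zoneLabel∘flip ② = refl
  zoneLabel∘flip ③ = refl

  zone : ∀ x → Cut Dp Rp Lp (residue x)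
  zone x = cut Dp Rp Lp (residue x) (n%ℕd<d (φ x) Np)

  τ : Pt → Tile
  τ x = zoneLabel (part (zone x))

  τ-resp-residue : ∀ {x y} → residue x ≡ residue y → τ x ≡ τ y
  τ-resp-residue {x} {y} eq = cong zoneLabel (cut-unique eq (zone x) (zone y))

  φ-ξ-zone : ∀ p → φ (ξ (zoneLabel p)) ≡ displacement Rp Lp p
  φ-ξ-zone ① = law (+ Lp) (+ Rp)
    where law : ∀ l r → (l + r) * + 0 + l * + 0 ≡ 0ℤ
          law = solve-∀
  φ-ξ-zone ② = law (+ Lp) (+ Rp)
    where law : ∀ l r → (l + r) * + 0 + l * + 1 ≡ l
          law = solve-∀
  φ-ξ-zone ③ = law (+ Lp) (+ Rp)
    where law : ∀ l r → (l + r) * - + 1 + l * + 1 ≡ - r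
          law = solve-∀

  φ-ξ-image : ∀ p → - φ (ξ (imageLabel p)) ≡ displacement Lp Rp p
  φ-ξ-image ① = law (+ Lp) (+ Rp)
    where law : ∀ l r → - ((l + r) * + 0 + l * + 0) ≡ 0ℤ
          law = solve-∀
  φ-ξ-image ② = law (+ Lp) (+ Rp)
    where law : ∀ l r → - ((l + r) * - + 1 + l * + 1) ≡ r
          law = solve-∀
  φ-ξ-image ③ = law (+ Lp) (+ Rp)
    where law : ∀ l r → - ((l + r) * + 0 + l * + 1) ≡ - l
          law = solve-∀

  -- Under φ mod Np, the move x ↦ x + ξ(τ x) is the exchange of the R-block and the L-block.
  residue-shift : ∀ x → residue (shift τ x) ≡ proj₁ (exchange (zone x))
  residue-shift x = residue-step₀ x (shift τ x) (φ (ξ (τ x))) (exchange< (zone x)) (∙-distribˡ-⊕ (typeNormal Lp Rp) x (ξ (τ x)))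
    (trans (cong (λ δ → + residue x + δ) (φ-ξ-zone (part (zone x)))) (exchange-displacement (zone x)))

  shift-injective : Injective _≡_ _≡_ (shift τ)
  shift-injective {x} {y} eq = ⊕-cancelʳ (ξ (τ x)) (trans eq (cong (λ t → y ⊕ ξ t) (sym τx≡τy)))
    where
    zx = zone x
    zy = zone y
    flipped : flip (part zx) ≡ flip (part zy)
    flipped = begin
      flip (part zx)                   ≡⟨ part-exchange zx ⟨
      part (proj₂ (exchange zx))       ≡⟨ cut-unique (trans (sym (residue-shift x)) (trans (cong residue eq) (residue-shift y)))
                                                     (proj₂ (exchange zx)) (proj₂ (exchange zy)) ⟩
      part (proj₂ (exchange zy))       ≡⟨ part-exchange zy ⟩
      flip (part zy)                   ∎
      where open ≡-Reasoning
    τx≡τy : τ x ≡ τ y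
    τx≡τy = cong zoneLabel (trans (sym (flip-involutive (part zx))) (trans (cong flip flipped) (flip-involutive (part zy))))

  shift-surjective : Surjective _≡_ _≡_ (shift τ)
  shift-surjective y = x , λ { refl → trans (cong (λ t → x ⊕ ξ t) τx≡t) ([x⊖y]⊕y≡x y (ξ t)) }
    where
    w = cut Dp Lp Rp (residue y) (subst (residue y ℕ.<_) (a+b+c≡a+c+b Dp Rp Lp) (n%ℕd<d (φ y) Np))
    t = imageLabel (part w)
    x = y ⊖ ξ t
    residue-x : residue x ≡ proj₁ (exchange w)
    residue-x = residue-step₀ y x (- φ (ξ t)) (cut< (proj₂ (exchange w))) (∙-distribˡ-⊖ (typeNormal Lp Rp) y (ξ t))
      (trans (cong (λ δ → + residue y + δ) (φ-ξ-image (part w))) (exchange-displacement w))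
    τx≡t : τ x ≡ t
    τx≡t = begin
      zoneLabel (part (zone x))                  ≡⟨ cong zoneLabel (cut-unique residue-x (zone x) (proj₂ (exchange w))) ⟩
      zoneLabel (part (proj₂ (exchange w)))      ≡⟨ cong zoneLabel (part-exchange w) ⟩
      zoneLabel (flip (part w))                  ≡⟨ zoneLabel∘flip (part w) ⟩
      imageLabel (part w)                        ∎
      where open ≡-Reasoning

  residue-periodic : ∀ x y → + Np ∣ φ y → residue (x ⊕ y) ≡ residue x
  residue-periodic x y (divides m φy≡mNp) =
    residue-step x (x ⊕ y) (φ y) m (n%ℕd<d (φ x) Np) (∙-distribˡ-⊕ (typeNormal Lp Rp) x y) (cong (λ δ → + residue x + δ) φy≡mNp)

  isTiling : ∀ B → (∀ {y} → InΛ B y → + Np ∣ φ y) → IsTiling B τ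
  isTiling B Np∣φ = (λ x y y∈Λ → τ-resp-residue (residue-periodic x y (Np∣φ y∈Λ))) , shift-injective , shift-surjective

  𝟙 : Bool → ℕ
  𝟙 true  = 1
  𝟙 false = 0

  𝟙-T : ∀ {b} → T b → 𝟙 b ≡ 1
  𝟙-T {true} _ = refl

  𝟙-¬T : ∀ {b} → ¬ T b → 𝟙 b ≡ 0
  𝟙-¬T {true}  ¬T = ⊥-elim (¬T _)
  𝟙-¬T {false} _  = refl

  𝟙-< : ∀ {s A} → s ℕ.< A → 𝟙 (s ℕ.<ᵇ A) ≡ 1
  𝟙-< s<A = 𝟙-T (ℕₚ.<⇒<ᵇ s<A)

  𝟙-≥ : ∀ {s A} → A ℕ.≤ s → 𝟙 (s ℕ.<ᵇ A) ≡ 0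
  𝟙-≥ {s} {A} A≤s = 𝟙-¬T (λ T< → ℕₚ.≤⇒≯ A≤s (ℕₚ.<ᵇ⇒< s A T<))

  𝟙-<ᵇ-suc : ∀ s A → 𝟙 (s ℕ.<ᵇ ℕ.suc A) ≡ 𝟙 (s ℕ.<ᵇ A) ℕ.+ 𝟙 (s ℕ.≡ᵇ A)
  𝟙-<ᵇ-suc ℕ.zero    ℕ.zero    = refl
  𝟙-<ᵇ-suc ℕ.zero    (ℕ.suc A) = refl
  𝟙-<ᵇ-suc (ℕ.suc s) ℕ.zero    = refl
  𝟙-<ᵇ-suc (ℕ.suc s) (ℕ.suc A) = 𝟙-<ᵇ-suc s A

  blockStart blockSize : Tile → ℕ
  blockStart D = 0
  blockStart R = Dp
  blockStart L = Dp ℕ.+ Rp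
  blockSize D = Dp
  blockSize R = Rp
  blockSize L = Lp

  blockEnd≤Np : ∀ t → blockStart t ℕ.+ blockSize t ℕ.≤ Np
  blockEnd≤Np D = ℕₚ.≤-trans (ℕₚ.m≤m+n Dp Rp) (ℕₚ.m≤m+n (Dp ℕ.+ Rp) Lp)
  blockEnd≤Np R = ℕₚ.m≤m+n (Dp ℕ.+ Rp) Lp
  blockEnd≤Np L = ℕₚ.≤-refl

  𝟙-block : ∀ t {s} → s ℕ.< Np → (z : Cut Dp Rp Lp s) →
            𝟙 (t ==ᵗ zoneLabel (part z)) ℕ.+ 𝟙 (s ℕ.<ᵇ blockStart t) ≡ 𝟙 (s ℕ.<ᵇ blockStart t ℕ.+ blockSize t)
  𝟙-block D _ (first s<Dp)            = sym (𝟙-< s<Dp)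
  𝟙-block D _ (second k refl _)       = sym (𝟙-≥ (ℕₚ.m≤m+n Dp k))
  𝟙-block D _ (third k refl _)        = sym (𝟙-≥ (ℕₚ.≤-trans (ℕₚ.m≤m+n Dp Rp) (ℕₚ.m≤m+n (Dp ℕ.+ Rp) k)))
  𝟙-block R _ (first s<Dp)            = trans (𝟙-< s<Dp) (sym (𝟙-< (ℕₚ.<-≤-trans s<Dp (ℕₚ.m≤m+n Dp Rp))))
  𝟙-block R _ (second k refl k<Rp)    = trans (cong ℕ.suc (𝟙-≥ (ℕₚ.m≤m+n Dp k))) (sym (𝟙-< (ℕₚ.+-monoʳ-< Dp k<Rp)))
  𝟙-block R _ (third k refl _)        = trans (𝟙-≥ (ℕₚ.≤-trans (ℕₚ.m≤m+n Dp Rp) (ℕₚ.m≤m+n (Dp ℕ.+ Rp) k)))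
                                              (sym (𝟙-≥ (ℕₚ.m≤m+n (Dp ℕ.+ Rp) k)))
  𝟙-block L s<Np (first s<Dp)         = trans (𝟙-< (ℕₚ.<-≤-trans s<Dp (ℕₚ.m≤m+n Dp Rp))) (sym (𝟙-< s<Np))
  𝟙-block L s<Np (second k refl k<Rp) = trans (𝟙-< (ℕₚ.+-monoʳ-< Dp k<Rp)) (sym (𝟙-< s<Np))
  𝟙-block L s<Np (third k refl _)     = trans (cong ℕ.suc (𝟙-≥ (ℕₚ.m≤m+n (Dp ℕ.+ Rp) k))) (sym (𝟙-< s<Np))

  count-as-sum : ∀ (σ : Pt → Tile) t xs → count t (map σ xs) ≡ sum (λ i → 𝟙 (t ==ᵗ σ (lookup xs i)))
  count-as-sum σ t []       = refl
  count-as-sum σ t (x ∷ xs) with t ==ᵗ σ x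
  ... | true  = cong ℕ.suc (count-as-sum σ t xs)
  ... | false = count-as-sum σ t xs

  sum-ones : ∀ n → sum {n} (λ _ → 1) ≡ n
  sum-ones ℕ.zero    = refl
  sum-ones (ℕ.suc n) = cong ℕ.suc (sum-ones n)

  -- t₀ raises φ by 1 modulo Np and permutes the classes of any transversal, so all residues are equally frequent.
  module Equidistribution (B : Mat) (Np∣φ : ∀ {y} → InΛ B y → + Np ∣ φ y)
                          (t₀ : Pt) (m : ℤ) (φt₀≡ : φ t₀ ≡ + 1 + m * + Np)
                          (xs : List Pt) (T : IsTransversal B xs) (e : ℕ) (length≡ : length xs ≡ Np ℕ.* e) where

    open Classes B xs T

    residue-respΛ : ∀ x y → InΛ B (x ⊖ y) → residue x ≡ residue y
    residue-respΛ x y x-y∈Λ = trans (cong residue (sym (x⊕[y⊖x]≡y y x))) (residue-periodic y (x ⊖ y) (Np∣φ x-y∈Λ))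

    translate-injectiveModΛ : InjectiveModΛ B (_⊕ t₀)
    translate-injectiveModΛ x y = subst (InΛ B) ([x⊕z]⊖[y⊕z]≡x⊖y x y t₀)

    residue-translate : ∀ x → ℕ.suc (residue x) ℕ.< Np → residue (x ⊕ t₀) ≡ ℕ.suc (residue x)
    residue-translate x r+1<Np = residue-step x (x ⊕ t₀) (φ t₀) m r+1<Np (∙-distribˡ-⊕ (typeNormal Lp Rp) x t₀)
      (trans (cong (λ δ → + residue x + δ) φt₀≡) (law (+ residue x) m (+ Np)))
      where law : ∀ r m n → r + (+ 1 + m * n) ≡ + 1 + r + m * n
            law = solve-∀

    residue-wrap : ∀ x → ℕ.suc (residue x) ≡ Np → residue (x ⊕ t₀) ≡ 0
    residue-wrap x r+1≡Np = residue-step x (x ⊕ t₀) (φ t₀) (m + + 1) (ℕ.>-nonZero⁻¹ Np) (∙-distribˡ-⊕ (typeNormal Lp Rp) x t₀)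
      (trans (cong (λ δ → + residue x + δ) φt₀≡)
      (trans (law₁ (+ residue x) m (+ Np))
      (trans (cong (λ n → n + m * + Np) (cong +_ r+1≡Np)) (law₂ m (+ Np)))))
      where law₁ : ∀ r m n → r + (+ 1 + m * n) ≡ + 1 + r + m * n
            law₁ = solve-∀
            law₂ : ∀ m n → n + m * n ≡ + 0 + (m + + 1) * n
            law₂ = solve-∀

    𝟙-translate : ∀ x h → ℕ.suc h ℕ.< Np → 𝟙 (residue (x ⊕ t₀) ℕ.≡ᵇ ℕ.suc h) ≡ 𝟙 (residue x ℕ.≡ᵇ h)
    𝟙-translate x h h+1<Np with ℕₚ.m≤n⇒m<n∨m≡n (n%ℕd<d (φ x) Np)
    ... | inj₁ r+1<Np = cong (λ s → 𝟙 (s ℕ.≡ᵇ ℕ.suc h)) (residue-translate x r+1<Np)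
    ... | inj₂ r+1≡Np = trans (cong (λ s → 𝟙 (s ℕ.≡ᵇ ℕ.suc h)) (residue-wrap x r+1≡Np))
      (sym (𝟙-¬T (λ r≡ᵇh → ℕₚ.<-irrefl (trans (cong ℕ.suc (sym (ℕₚ.≡ᵇ⇒≡ (residue x) h r≡ᵇh))) r+1≡Np) h+1<Np)))

    occurrences below : ℕ → ℕ
    occurrences h = sum (λ i → 𝟙 (residue (lookup xs i) ℕ.≡ᵇ h))
    below A = sum (λ i → 𝟙 (residue (lookup xs i) ℕ.<ᵇ A))

    occurrences-suc : ∀ h → ℕ.suc h ℕ.< Np → occurrences (ℕ.suc h) ≡ occurrences h
    occurrences-suc h h+1<Np = begin
      occurrences (ℕ.suc h)                     ≡⟨ sum-periodic-∘ ℕₚ.+-0-commutativeMonoid (_⊕ t₀) F F-periodic translate-injectiveModΛ ⟨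
      sum (λ i → F (lookup xs i ⊕ t₀))          ≡⟨ sum-cong-≗ (λ i → 𝟙-translate (lookup xs i) h h+1<Np) ⟩
      occurrences h                             ∎
      where
      open ≡-Reasoning
      F : Pt → ℕ
      F x = 𝟙 (residue x ℕ.≡ᵇ ℕ.suc h)
      F-periodic : ∀ x y → InΛ B (x ⊖ y) → F x ≡ F y
      F-periodic x y x-y∈Λ = cong (λ s → 𝟙 (s ℕ.≡ᵇ ℕ.suc h)) (residue-respΛ x y x-y∈Λ)

    occurrences-uniform : ∀ h → h ℕ.< Np → occurrences h ≡ occurrences 0
    occurrences-uniform ℕ.zero    _       = refl
    occurrences-uniform (ℕ.suc h) h+1<Np = trans (occurrences-suc h h+1<Np) (occurrences-uniform h (ℕₚ.<-trans (ℕₚ.n<1+n h) h+1<Np))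

    below-linear : ∀ A → A ℕ.≤ Np → below A ≡ A ℕ.* occurrences 0
    below-linear ℕ.zero    _       = sum-replicate-zero (length xs)
    below-linear (ℕ.suc A) A+1≤Np = begin
      below (ℕ.suc A)                        ≡⟨ sum-cong-≗ (λ i → 𝟙-<ᵇ-suc (residue (lookup xs i)) A) ⟩
      sum (λ i → 𝟙 (residue (lookup xs i) ℕ.<ᵇ A) ℕ.+ 𝟙 (residue (lookup xs i) ℕ.≡ᵇ A))
                                             ≡⟨ ∑-distrib-+ (λ i → 𝟙 (residue (lookup xs i) ℕ.<ᵇ A)) (λ i → 𝟙 (residue (lookup xs i) ℕ.≡ᵇ A)) ⟩
      below A ℕ.+ occurrences A              ≡⟨ cong₂ ℕ._+_ (below-linear A (ℕₚ.<⇒≤ A+1≤Np)) (occurrences-uniform A A+1≤Np) ⟩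
      A ℕ.* occurrences 0 ℕ.+ occurrences 0  ≡⟨ ℕₚ.+-comm (A ℕ.* occurrences 0) (occurrences 0) ⟩
      ℕ.suc A ℕ.* occurrences 0              ∎
      where open ≡-Reasoning

    occurrences-0 : occurrences 0 ≡ e
    occurrences-0 = ℕₚ.*-cancelˡ-≡ (occurrences 0) e Np (begin
      Np ℕ.* occurrences 0   ≡⟨ below-linear Np ℕₚ.≤-refl ⟨
      below Np               ≡⟨ sum-cong-≗ (λ i → 𝟙-< (n%ℕd<d (φ (lookup xs i)) Np)) ⟩
      sum {length xs} (λ _ → 1) ≡⟨ sum-ones (length xs) ⟩
      length xs              ≡⟨ length≡ ⟩
      Np ℕ.* e               ∎)
      where open ≡-Reasoning

    count-tile : ∀ t → count t (map τ xs) ≡ blockSize t ℕ.* e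
    count-tile t = ℕₚ.+-cancelʳ-≡ (blockStart t ℕ.* e) _ _ (begin
      count t (map τ xs) ℕ.+ blockStart t ℕ.* e
        ≡⟨ cong₂ ℕ._+_ (count-as-sum τ t xs) (sym (trans (below-linear (blockStart t) start≤Np) (cong (blockStart t ℕ.*_) occurrences-0))) ⟩
      sum (λ i → 𝟙 (t ==ᵗ τ (lookup xs i))) ℕ.+ below (blockStart t)
        ≡⟨ ∑-distrib-+ (λ i → 𝟙 (t ==ᵗ τ (lookup xs i))) (λ i → 𝟙 (residue (lookup xs i) ℕ.<ᵇ blockStart t)) ⟨
      sum (λ i → 𝟙 (t ==ᵗ τ (lookup xs i)) ℕ.+ 𝟙 (residue (lookup xs i) ℕ.<ᵇ blockStart t))
        ≡⟨ sum-cong-≗ (λ i → 𝟙-block t (n%ℕd<d (φ (lookup xs i)) Np) (zone (lookup xs i))) ⟩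
      below (blockStart t ℕ.+ blockSize t)
        ≡⟨ trans (below-linear _ (blockEnd≤Np t)) (cong ((blockStart t ℕ.+ blockSize t) ℕ.*_) occurrences-0) ⟩
      (blockStart t ℕ.+ blockSize t) ℕ.* e
        ≡⟨ ℕₚ.*-distribʳ-+ e (blockStart t) (blockSize t) ⟩
      blockStart t ℕ.* e ℕ.+ blockSize t ℕ.* e
        ≡⟨ ℕₚ.+-comm (blockStart t ℕ.* e) (blockSize t ℕ.* e) ⟩
      blockSize t ℕ.* e ℕ.+ blockStart t ℕ.* e ∎)
      where
      open ≡-Reasoning
      start≤Np = ℕₚ.≤-trans (ℕₚ.m≤m+n (blockStart t) (blockSize t)) (blockEnd≤Np t)

module Sufficiency where

  open Points
  open Lattice using (∣∙-on-Λ)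
  open Transversals using (transversal-exists)
  open IntegerArithmetic using (bézout₃)
  open Necessity using (typeNormal; TypeDivisible)
  open import Data.Empty using (⊥-elim)
  open import Data.Integer using (ℤ; +_; -_; _+_; _-_; _*_; 0ℤ)
  open import Data.Integer.Divisibility.Signed using (_∣_; *-cancelˡ-∣)
  import Data.Integer.Properties as ℤₚ
  open import Data.Integer.Tactic.RingSolver using (solve-∀)
  open import Data.Nat as ℕ using (ℕ; NonZero)
  open import Data.Nat.Divisibility using (divides; ∣-trans) renaming (_∣_ to _∣ℕ_)
  open import Data.Nat.GCD using (gcd; gcd[m,n]∣m; gcd[m,n]∣n)
  import Data.Nat.Properties as ℕₚ
  import Data.Nat.Tactic.RingSolver as ℕSolver
  open import Data.Product using (Σ; ∃; ∃₂; _×_; _,_)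
  open import Relation.Binary.PropositionalEquality

  module Reduced (B : Mat) (det≢0 : det B ≢ 0ℤ) (Lp Dp Rp e : ℕ) .{{_ : NonZero e}}
                 (κ μ ν : ℤ) (κμν : κ * + (Lp ℕ.* e) + μ * + (Rp ℕ.* e) + ν * + (Dp ℕ.* e) ≡ + e)
                 (index≡ : index B ≡ (Dp ℕ.+ Rp ℕ.+ Lp) ℕ.* e)
                 (N∣a : + index B ∣ typeNormal (Lp ℕ.* e) (Rp ℕ.* e) ∙ col-a B)
                 (N∣b : + index B ∣ typeNormal (Lp ℕ.* e) (Rp ℕ.* e) ∙ col-b B) where

    instance
      Np≢0 : NonZero (Dp ℕ.+ Rp ℕ.+ Lp)
      Np≢0 = ℕ.≢-nonZero (λ Np≡0 → det≢0 (ℤₚ.∣i∣≡0⇒i≡0 (trans index≡ (cong (ℕ._* e) Np≡0))))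

    open ResidueTiling Dp Rp Lp

    pos-*-e : ∀ n → + (n ℕ.* e) ≡ + n * + e
    pos-*-e n = ℤₚ.pos-* n e

    typeNormal-scale : ∀ c → typeNormal (Lp ℕ.* e) (Rp ℕ.* e) ∙ c ≡ + e * φ c
    typeNormal-scale (c₁ , c₂) =
      trans (cong₂ (λ l r → (l + r) * c₁ + l * c₂) (pos-*-e Lp) (pos-*-e Rp)) (law (+ Lp) (+ Rp) (+ e) c₁ c₂)
      where law : ∀ l r e c₁ c₂ → (l * e + r * e) * c₁ + l * e * c₂ ≡ e * ((l + r) * c₁ + l * c₂)
            law = solve-∀

    Np∣φ-generator : ∀ c → + index B ∣ typeNormal (Lp ℕ.* e) (Rp ℕ.* e) ∙ c → + Np ∣ φ c
    Np∣φ-generator c N∣c = *-cancelˡ-∣ (+ e) (subst₂ _∣_ N≡eNp (typeNormal-scale c) N∣c)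
      where N≡eNp : + index B ≡ + e * + Np
            N≡eNp = trans (cong +_ (trans index≡ (ℕₚ.*-comm Np e))) (ℤₚ.pos-* e Np)

    Np∣φ : ∀ {y} → InΛ B y → + Np ∣ φ y
    Np∣φ = ∣∙-on-Λ B (typeNormal Lp Rp) (Np∣φ-generator (col-a B) N∣a) (Np∣φ-generator (col-b B) N∣b)

    unit : κ * + Lp + μ * + Rp + ν * + Dp ≡ + 1
    unit = ℤₚ.*-cancelˡ-≡ (+ e) _ (+ 1) (begin
      + e * (κ * + Lp + μ * + Rp + ν * + Dp)           ≡⟨ law κ μ ν (+ Lp) (+ Rp) (+ Dp) (+ e) ⟩
      κ * (+ Lp * + e) + μ * (+ Rp * + e) + ν * (+ Dp * + e) ≡⟨ cong₂ (λ u w → κ * u + μ * w + ν * (+ Dp * + e)) (pos-*-e Lp) (pos-*-e Rp) ⟨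
      κ * + (Lp ℕ.* e) + μ * + (Rp ℕ.* e) + ν * (+ Dp * + e) ≡⟨ cong (λ w → κ * + (Lp ℕ.* e) + μ * + (Rp ℕ.* e) + ν * w) (pos-*-e Dp) ⟨
      κ * + (Lp ℕ.* e) + μ * + (Rp ℕ.* e) + ν * + (Dp ℕ.* e) ≡⟨ κμν ⟩
      + e                                               ≡⟨ ℤₚ.*-identityʳ (+ e) ⟨
      + e * + 1                                         ∎)
      where
      open ≡-Reasoning
      law : ∀ κ μ ν l r d e → e * (κ * l + μ * r + ν * d) ≡ κ * (l * e) + μ * (r * e) + ν * (d * e)
      law = solve-∀

    -- φ (μ - ν, κ - μ) = κ Lp + μ Rp + ν Dp - ν Np ≡ 1 (mod Np).
    t₀ : Pt
    t₀ = (μ - ν , κ - μ)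

    φt₀≡ : φ t₀ ≡ + 1 + - ν * + Np
    φt₀≡ = trans (law (+ Lp) (+ Rp) (+ Dp) κ μ ν) (cong (λ z → z + - ν * + Np) unit)
      where law : ∀ l r d κ μ ν → (l + r) * (μ - ν) + l * (κ - μ) ≡ κ * l + μ * r + ν * d + - ν * (d + r + l)
            law = solve-∀

    tiling : Σ (Pt → Tile) λ σ → IsTiling B σ × HasType B σ (Lp ℕ.* e) (Dp ℕ.* e) (Rp ℕ.* e)
    tiling with transversal-exists B det≢0
    ... | xs , T , length≡ = τ , isTiling B Np∣φ , xs , T , count-tile L , count-tile D , count-tile R
      where open Equidistribution B Np∣φ t₀ (- ν) φt₀≡ xs T e (trans length≡ index≡)

  common-divisor⇒tiling : ∀ B → det B ≢ 0ℤ → ∀ nL nD nR e → e ∣ℕ nL → e ∣ℕ nR → e ∣ℕ nD →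
                          (∃₂ λ κ μ → ∃ λ ν → κ * + nL + μ * + nR + ν * + nD ≡ + e) → nL ℕ.+ nD ℕ.+ nR ≡ index B →
                          TypeDivisible (+ index B) B nL nR → Σ (Pt → Tile) λ τ → IsTiling B τ × HasType B τ nL nD nR
  common-divisor⇒tiling B det≢0 _ _ _ ℕ.zero (divides Lp refl) (divides Rp refl) (divides Dp refl) _ n≡ _ =
    ⊥-elim (det≢0 (ℤₚ.∣i∣≡0⇒i≡0 (trans (sym n≡) (law Lp Dp Rp))))
    where law : ∀ l d r → l ℕ.* 0 ℕ.+ d ℕ.* 0 ℕ.+ r ℕ.* 0 ≡ 0
          law = ℕSolver.solve-∀
  common-divisor⇒tiling B det≢0 _ _ _ e@(ℕ.suc _) (divides Lp refl) (divides Rp refl) (divides Dp refl)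
                        (κ , μ , ν , κμν) n≡ (N∣a , N∣b) =
    Reduced.tiling B det≢0 Lp Dp Rp e κ μ ν κμν (trans (sym n≡) (law Lp Dp Rp e)) N∣a N∣b
    where law : ∀ l d r e → l ℕ.* e ℕ.+ d ℕ.* e ℕ.+ r ℕ.* e ≡ (d ℕ.+ r ℕ.+ l) ℕ.* e
          law = ℕSolver.solve-∀

  TypeDivisible⇒tiling : ∀ B → det B ≢ 0ℤ → ∀ nL nD nR → nL ℕ.+ nD ℕ.+ nR ≡ index B →
                         TypeDivisible (+ index B) B nL nR → Σ (Pt → Tile) λ τ → IsTiling B τ × HasType B τ nL nD nR
  TypeDivisible⇒tiling B det≢0 nL nD nR =
    common-divisor⇒tiling B det≢0 nL nD nR (gcd (gcd nL nR) nD)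
      (∣-trans (gcd[m,n]∣m (gcd nL nR) nD) (gcd[m,n]∣m nL nR)) (∣-trans (gcd[m,n]∣m (gcd nL nR) nD) (gcd[m,n]∣n nL nR))
      (gcd[m,n]∣n (gcd nL nR) nD) (bézout₃ nL nR nD)

open Necessity using (TypeDivisible; tiling⇒TypeDivisible)
open CosetCondition using (InCoset⇔TypeDivisible)
open Sufficiency using (TypeDivisible⇒tiling)

open import Data.Integer using (ℤ; +_)
open import Data.Nat using (ℕ; _+_)
open import Data.Product using (Σ; _×_)
open import Function.Bundles using (_⇔_)
open import Relation.Binary.PropositionalEquality using (_≡_; _≢_)

open import Data.Integer.Divisibility.Signed using (∣-trans; ∣m∣∣m)
open import Data.Product using (_,_; map)
open import Function.Bundles using (mk⇔; Equivalence)

mainTheorem4 : (B : Mat) → det B ≢ + 0 →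
    (ΔL ΔD ΔR : Pt) →
    Fingerprint (constTiling L) B ΔL →
    Fingerprint (constTiling D) B ΔD →
    Fingerprint (constTiling R) B ΔR →
    (nL nD nR : ℕ) → nL + nD + nR ≡ index B →
    (Σ (Pt → Tile) (λ τ → IsTiling B τ × HasType B τ nL nD nR))
    ⇔ InCoset (index B) nL nD nR ΔL ΔD ΔR
mainTheorem4 B det≢0 ΔL ΔD ΔR fL fD fR nL nD nR n≡ = mk⇔ necessary sufficient
  where
  coset⇔divisible : InCoset (index B) nL nD nR ΔL ΔD ΔR ⇔ TypeDivisible (+ index B) B nL nR
  coset⇔divisible = InCoset⇔TypeDivisible nL nD nR B fL fD fR n≡
  necessary : Σ (Pt → Tile) (λ τ → IsTiling B τ × HasType B τ nL nD nR) → InCoset (index B) nL nD nR ΔL ΔD ΔR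
  necessary (_ , tiling , type) =
    Equivalence.from coset⇔divisible (map (∣-trans ∣m∣∣m) (∣-trans ∣m∣∣m) (tiling⇒TypeDivisible tiling type))
  sufficient : InCoset (index B) nL nD nR ΔL ΔD ΔR → Σ (Pt → Tile) (λ τ → IsTiling B τ × HasType B τ nL nD nR)
  sufficient coset = TypeDivisible⇒tiling B det≢0 nL nD nR n≡ (Equivalence.to coset⇔divisible coset)
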